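{- Let $k\ge1$, $1\le r\le k$, and $\ell\in\mathbb Z$. In the $0$-Hecke algebra $H_{k+1}$, $$\sum_{a=0}^{r}\ \sum_{\ell-k+1+r-a\le p_1<\cdots<p_a\le\ell}D_{\mathfrak r(\ell+r-a)}\cdots D_{\mathfrak r(\ell+1)}\,T_{\mathfrak r(p_a)}\cdots T_{\mathfrak r(p_1)}=\sum_{A\subset I,\ |A|\le r}T_{u_A},$$ where $D_i=T_i+1$, and the product $D_{\mathfrak r(\ell+r-a)}\cdots D_{\mathfrak r(\ell+1)}$ is empty (equal to $1$) when $a=r$.
   Context: $I=\mathbb Z/(k+1)\mathbb Z$, and $\mathfrak r(p)\in I$ is the residue of $1-p$ mod $k+1$ for $p\in\mathbb Z$. $\tilde S_{k+1}$ is the affine symmetric group generated by $s_i$ ($i\in I$) with $s_i^2=1$, $s_is_{i+1}s_i=s_{i+1}s_is_{i+1}$, and $s_is_j=s_js_i$ for $i-j\not\equiv0,\pm1$. For $A\subsetneq I$, $u_A$ is the product of $s_i$, $i\in A$, ordered so that $i+1$ never appears to the left of $i$ (mod $k+1$); $u_\varnothing=1$. $H_{k+1}$ is the associative $\mathbb C$-algebra generated by $T_i$ ($i\in I$) with $T_i^2=-T_i$, $T_iT_{i+1}T_i=T_{i+1}T_iT_{i+1}$, and $T_iT_j=T_jT_i$ for $i-j\not\equiv0,\pm1$. $T_w=T_{i_1}\cdots T_{i_m}$ for any reduced word $w=s_{i_1}\cdots s_{i_m}$. -}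

module Defs where

open import Level using (Level)
open import Data.Bool using (Bool; true; false; if_then_else_)
open import Data.Nat as ℕ using (ℕ; zero; suc; _≤?_)
import Data.Nat.DivMod as NDM
open import Data.Integer as ℤ using (ℤ; +_)
open import Data.Integer.DivMod using (_%ℕ_)
open import Data.Fin using (Fin; toℕ)
open import Data.Fin.Subset using (Subset; ∣_∣)
open import Data.List using (List; []; _∷_; map; filter; reverse; upTo; allFin; _++_; concatMap)
open import Data.Vec using (Vec; lookup)
import Data.Vec as Vec
open import Data.Product using (_×_)
open import Relation.Binary.PropositionalEquality using (_≡_; _≢_)
open import Algebra.Bundles using (Ring)

-- Index set I = ℤ/(k+1)ℤ, represented as Fin (suc k).

next : ∀ {k} → Fin (suc k) → Fin (suc k)
next {k} i = NDM._mod_ (suc (toℕ i)) (suc k)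

Far : ∀ {k} → Fin (suc k) → Fin (suc k) → Set
Far i j = (i ≢ j) × (i ≢ next j) × (j ≢ next i)

𝔯 : (k : ℕ) → ℤ → Fin (suc k)
𝔯 k p = NDM._mod_ ((+ 1 ℤ.- p) %ℕ (suc k)) (suc k)

interval : ℤ → ℤ → List ℤ
interval lo hi = map (λ i → lo ℤ.+ + i) (upTo ℤ.∣ (hi ℤ.- lo ℤ.+ + 1) ℤ.⊔ + 0 ∣)

-- all sublists of length a (order preserved); applied to an increasing
-- list this enumerates the increasing a-tuples p₁ < ⋯ < p_a
choose : {A : Set} → ℕ → List A → List (List A)
choose zero    _        = [] ∷ []
choose (suc a) []       = []
choose (suc a) (x ∷ xs) = map (x ∷_) (choose a xs) ++ choose (suc a) xs

allSubsets : (n : ℕ) → List (Subset n)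
allSubsets zero    = Vec.[] ∷ []
allSubsets (suc n) = concatMap (λ s → (false Vec.∷ s) ∷ (true Vec.∷ s) ∷ []) (allSubsets n)

-- The word of u_A: for A ⊊ I let j be the least element of I not in A;
-- u_A = product of s_i (i ∈ A) in the order j+1, j+2, …, j+k (mod k+1),
-- so that i+1 never appears to the left of i.  (For A = I, which never
-- occurs below, j defaults to 0.)

firstOutside : ∀ {k} → Subset (suc k) → Fin (suc k)
firstOutside {k} A = go (allFin (suc k))
  where
  go : List (Fin (suc k)) → Fin (suc k)
  go []       = Data.Fin.zero
  go (i ∷ is) = if lookup A i then go is else i

wordU : ∀ {k} → Subset (suc k) → List (Fin (suc k))
wordU {k} A =
  filter (λ i → Data.Bool._≟_ (lookup A i) true)
    (map (λ m → NDM._mod_ (toℕ (firstOutside A) ℕ.+ suc m) (suc k)) (upTo k))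

module _ {c ℓ : Level} (R : Ring c ℓ) where
  open Ring R

  prod : List Carrier → Carrier
  prod []       = 1#
  prod (x ∷ xs) = x * prod xs

  sum : List Carrier → Carrier
  sum []       = 0#
  sum (x ∷ xs) = x + sum xs

  record IsZeroHecke (k : ℕ) (T : Fin (suc k) → Carrier) : Set (c Level.⊔ ℓ) where
    field
      quadratic : ∀ i → T i * T i ≈ - T i
      braid     : ∀ i → T i * T (next i) * T i ≈ T (next i) * T i * T (next i)
      commute   : ∀ i j → Far i j → T i * T j ≈ T j * T i

  Tu : (k : ℕ) → (Fin (suc k) → Carrier) → Subset (suc k) → Carrier
  Tu k T A = prod (map T (wordU A))

  LHS : (k r : ℕ) → ℤ → (Fin (suc k) → Carrier) → Carrier
  LHS k r l T = sum (map term (upTo (suc r)))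
    where
    D : Fin (suc k) → Carrier
    D i = T i + 1#
    term : ℕ → Carrier
    term a =
      sum (map (λ ps → prod (map (λ p → D (𝔯 k p)) (reverse (interval (l ℤ.+ + 1) (l ℤ.+ (+ r ℤ.- + a)))))
                       * prod (map (λ p → T (𝔯 k p)) (reverse ps)))
               (choose a (interval (l ℤ.- + k ℤ.+ + 1 ℤ.+ + r ℤ.- + a) l)))

  RHS : (k r : ℕ) → (Fin (suc k) → Carrier) → Carrier
  RHS k r T = sum (map (Tu k T) (filter (λ A → ∣ A ∣ ≤? r) (allSubsets (suc k))))

-- Expanding every Dᵢ = Tᵢ + 1, the a-th summand becomes a sum of words T_x over the
-- subsets of a window of k consecutive residues (the r - a residues of the D-factors
-- followed by those of the T-factors), with exactly a letters among the T-residues.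
-- Reading such a subset as a subset A of I, the word equals T_{u_A} as soon as the
-- residue just before the window lies outside A: moving the start of the window past a
-- maximal run of elements of A only commutes that run past letters at distance at
-- least 2 (only the commutation relations of H_{k+1} are used). For a fixed A, the
-- admissible a form the single crossing of a monotone lattice path, which exists
-- exactly when |A| ≤ r; so each T_{u_A} with |A| ≤ r is produced once.

{-# OPTIONS --safe #-}
module Submission where

open import Defs
open import Level using (Level)
open import Function using (_∘_)
open import Data.Bool using (Bool; true; false; if_then_else_; not; _∧_)
import Data.Bool
open import Data.Empty using (⊥-elim)
open import Data.Product using (Σ; _×_; _,_)
open import Data.Sum using (_⊎_; inj₁; inj₂)
open import Data.Nat as ℕ using (ℕ; zero; suc; _≤_; _<_; z≤n; s≤s; _∸_; _≡ᵇ_; _≤?_)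
import Data.Nat.Properties as ℕₚ
open import Data.Integer as ℤ using (ℤ)
open import Data.List using (List; []; _∷_; _++_; [_]; map; reverse; length; take; drop; upTo; filter; filterᵇ; allFin; concatMap)
open import Data.List.Relation.Unary.All as All using (All; []; _∷_)
open import Data.List.Membership.Propositional.Properties using (∈-allFin)
open import Data.List.Properties using (map-∘; map-upTo; map-++; unfold-reverse; reverse-++; length-reverse; ++-identityʳ; filter-++)
open import Data.Fin as Fin using (Fin; toℕ)
open import Data.Fin.Subset using (Subset; ∣_∣)
open import Data.Vec using (lookup)
import Data.Vec as Vec
open import Relation.Nullary using (does; yes; no)
open import Relation.Nullary.Decidable using (T?)
import Relation.Unary
open import Relation.Binary.PropositionalEquality as ≡ using (_≡_; _≢_)
open import Algebra.Bundles using (Ring)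

module _ where
  open import Data.Nat using (_+_)
  open ℕₚ using (+-identityʳ; +-suc)
  open ≡ hiding ([_])

  range : ℕ → ℕ → List ℕ
  range s zero    = []
  range s (suc m) = s ∷ range (suc s) m

  length-range : ∀ s m → length (range s m) ≡ m
  length-range s zero    = refl
  length-range s (suc m) = cong suc (length-range (suc s) m)

  range-++ : ∀ s p q → range s (p + q) ≡ range s p ++ range (s + p) q
  range-++ s zero    q = cong (λ t → range t q) (sym (+-identityʳ s))
  range-++ s (suc p) q =
    cong (s ∷_) (trans (range-++ (suc s) p q) (cong (λ t → range (suc s) p ++ range t q) (sym (+-suc s p))))

  at-zero : ∀ {a} {A : Set a} (f g : ℕ → A) s t → f (s + 0) ≡ g (t + 0) → f s ≡ g t
  at-zero f g s t e = trans (cong f (sym (+-identityʳ s))) (trans e (cong g (+-identityʳ t)))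

  at-suc : ∀ {a} {A : Set a} (f g : ℕ → A) s t i → f (s + suc i) ≡ g (t + suc i) → f (suc s + i) ≡ g (suc t + i)
  at-suc f g s t i e = trans (cong f (sym (+-suc s i))) (trans e (cong g (+-suc t i)))

  map-range-cong : ∀ {a} {A : Set a} {f g : ℕ → A} s t m → (∀ i → i < m → f (s + i) ≡ g (t + i)) →
                   map f (range s m) ≡ map g (range t m)
  map-range-cong s t zero    e = refl
  map-range-cong {f = f} {g} s t (suc m) e =
    cong₂ _∷_ (at-zero f g s t (e 0 (s≤s z≤n)))
              (map-range-cong (suc s) (suc t) m (λ i i<m → at-suc f g s t i (e (suc i) (s≤s i<m))))

  upTo≡range : ∀ m → upTo m ≡ range 0 m
  upTo≡range zero    = refl
  upTo≡range (suc m) =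
    cong (0 ∷_) (trans (sym (map-upTo suc m)) (trans (cong (map suc) (upTo≡range m)) (map-suc-range 0 m)))
    where
    map-suc-range : ∀ s m → map suc (range s m) ≡ range (suc s) m
    map-suc-range s zero    = refl
    map-suc-range s (suc m) = cong (suc s ∷_) (map-suc-range (suc s) m)

  map-range-+ : ∀ {a} {A : Set a} (g : ℕ → A) c s m → map (λ j → g (c + j)) (range s m) ≡ map g (range (c + s) m)
  map-range-+ g c s m = map-range-cong s (c + s) m (λ i _ → cong g (sym (ℕₚ.+-assoc c s i)))

  reverse-map-range : ∀ {a} {A : Set a} (g : ℕ → A) m → reverse (map g (range 0 m)) ≡ map (λ j → g (m ∸ suc j)) (range 0 m)
  reverse-map-range g zero    = refl
  reverse-map-range g (suc m) = begin
    reverse (map g (range 0 (suc m)))            ≡⟨ cong (reverse ∘ map g) (trans (cong (range 0) (ℕₚ.+-comm 1 m)) (range-++ 0 m 1)) ⟩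
    reverse (map g (range 0 m ++ [ m ]))         ≡⟨ cong reverse (map-++ g (range 0 m) [ m ]) ⟩
    reverse (map g (range 0 m) ++ [ g m ])       ≡⟨ reverse-++ (map g (range 0 m)) [ g m ] ⟩
    g m ∷ reverse (map g (range 0 m))            ≡⟨ cong (g m ∷_) (reverse-map-range g m) ⟩
    g m ∷ map (λ j → g (m ∸ suc j)) (range 0 m)  ≡⟨ cong (g m ∷_) (map-range-cong 0 1 m (λ _ _ → refl)) ⟩
    map (λ j → g (suc m ∸ suc j)) (range 0 (suc m)) ∎
    where open ≡-Reasoning

  take-map-range : ∀ {a} {A : Set a} (f : ℕ → A) s m i → i ≤ m → take i (map f (range s m)) ≡ map f (range s i)
  take-map-range f s m       zero    _         = refl
  take-map-range f s (suc m) (suc i) (s≤s i≤m) = cong (f s ∷_) (take-map-range f (suc s) m i i≤m)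

  drop-map-range : ∀ {a} {A : Set a} (f : ℕ → A) s m i → i ≤ m → drop i (map f (range s m)) ≡ map f (range (s + i) (m ∸ i))
  drop-map-range f s m       zero    _         = cong (λ t → map f (range t m)) (sym (+-identityʳ s))
  drop-map-range f s (suc m) (suc i) (s≤s i≤m) =
    trans (drop-map-range f (suc s) m i i≤m) (cong (λ t → map f (range t (m ∸ i))) (sym (+-suc s i)))

  take-length-++ : ∀ {a} {A : Set a} (xs ys : List A) → take (length xs) (xs ++ ys) ≡ xs
  take-length-++ []       ys = refl
  take-length-++ (x ∷ xs) ys = cong (x ∷_) (take-length-++ xs ys)

  drop-length-++ : ∀ {a} {A : Set a} (xs ys : List A) → drop (length xs) (xs ++ ys) ≡ ys
  drop-length-++ []       ys = refl
  drop-length-++ (x ∷ xs) ys = drop-length-++ xs ys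

  filterᵇ-range-all : ∀ (p : ℕ → Bool) s m → (∀ i → i < m → p (s + i) ≡ true) → filterᵇ p (range s m) ≡ range s m
  filterᵇ-range-all p s zero    _   = refl
  filterᵇ-range-all p s (suc m) all with p s | at-zero p (λ _ → true) s s (all 0 (s≤s z≤n))
  ... | true | _ = cong (s ∷_) (filterᵇ-range-all p (suc s) m (λ i i<m → at-suc p (λ _ → true) s s i (all (suc i) (s≤s i<m))))

  map-filterᵇ-range-cong : ∀ {a} {A : Set a} (p q : ℕ → Bool) (f g : ℕ → A) s t m →
    (∀ i → i < m → p (s + i) ≡ q (t + i)) → (∀ i → i < m → f (s + i) ≡ g (t + i)) →
    map f (filterᵇ p (range s m)) ≡ map g (filterᵇ q (range t m))
  map-filterᵇ-range-cong p q f g s t zero    _  _  = refl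
  map-filterᵇ-range-cong p q f g s t (suc m) ep ef with p s | q t | at-zero p q s t (ep 0 (s≤s z≤n))
  ... | true  | true  | _ = cong₂ _∷_ (at-zero f g s t (ef 0 (s≤s z≤n)))
                              (map-filterᵇ-range-cong p q f g (suc s) (suc t) m (λ i i<m → at-suc p q s t i (ep (suc i) (s≤s i<m)))
                                                                               (λ i i<m → at-suc f g s t i (ef (suc i) (s≤s i<m))))
  ... | false | false | _ = map-filterᵇ-range-cong p q f g (suc s) (suc t) m (λ i i<m → at-suc p q s t i (ep (suc i) (s≤s i<m)))
                                                                             (λ i i<m → at-suc f g s t i (ef (suc i) (s≤s i<m)))

  filterᵇ-∷-false : ∀ {a} {A : Set a} (p : A → Bool) x xs → p x ≡ false → filterᵇ p (x ∷ xs) ≡ filterᵇ p xs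
  filterᵇ-∷-false p x xs px with p x
  filterᵇ-∷-false p x xs refl | false = refl

  filterᵇ-range-split : ∀ (p : ℕ → Bool) s a b → p (s + a) ≡ false →
                        filterᵇ p (range s (a + suc b)) ≡ filterᵇ p (range s a) ++ filterᵇ p (range (suc (s + a)) b)
  filterᵇ-range-split p s a b pa = begin
    filterᵇ p (range s (a + suc b))                       ≡⟨ cong (filterᵇ p) (range-++ s a (suc b)) ⟩
    filterᵇ p (range s a ++ range (s + a) (suc b))        ≡⟨ filter-++ (T? ∘ p) (range s a) _ ⟩
    filterᵇ p (range s a) ++ filterᵇ p (range (s + a) (suc b)) ≡⟨ cong (filterᵇ p (range s a) ++_) (filterᵇ-∷-false p (s + a) _ pa) ⟩
    filterᵇ p (range s a) ++ filterᵇ p (range (suc (s + a)) b) ∎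
    where open ≡-Reasoning

  select : ∀ {a} {A : Set a} → List Bool → List A → List A
  select []          _        = []
  select (_ ∷ _)     []       = []
  select (true ∷ X)  (y ∷ ys) = y ∷ select X ys
  select (false ∷ X) (y ∷ ys) = select X ys

  select-map : ∀ {a b} {A : Set a} {B : Set b} (f : A → B) X xs → select X (map f xs) ≡ map f (select X xs)
  select-map f []          xs       = refl
  select-map f (_ ∷ _)     []       = refl
  select-map f (true ∷ X)  (y ∷ ys) = cong (f y ∷_) (select-map f X ys)
  select-map f (false ∷ X) (y ∷ ys) = select-map f X ys

  select-++ : ∀ {a} {A : Set a} X (xs : List A) Y ys → length X ≡ length xs → select (X ++ Y) (xs ++ ys) ≡ select X xs ++ select Y ys
  select-++ []          []       Y ys e = refl
  select-++ (true ∷ X)  (x ∷ xs) Y ys e = cong (x ∷_) (select-++ X xs Y ys (ℕₚ.suc-injective e))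
  select-++ (false ∷ X) (x ∷ xs) Y ys e = select-++ X xs Y ys (ℕₚ.suc-injective e)

  reverse-select : ∀ {a} {A : Set a} X (xs : List A) → length X ≡ length xs → reverse (select X xs) ≡ select (reverse X) (reverse xs)
  reverse-select []      []       e = refl
  reverse-select (b ∷ X) (x ∷ xs) e = begin
    reverse (select (b ∷ X) (x ∷ xs))                 ≡⟨ last b ⟩
    select (reverse X) (reverse xs) ++ select [ b ] [ x ] ≡⟨ sym (select-++ (reverse X) (reverse xs) [ b ] [ x ] lengths) ⟩
    select (reverse X ++ [ b ]) (reverse xs ++ [ x ]) ≡⟨ sym (cong₂ select (unfold-reverse b X) (unfold-reverse x xs)) ⟩
    select (reverse (b ∷ X)) (reverse (x ∷ xs))       ∎
    where
    open ≡-Reasoning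
    lengths : length (reverse X) ≡ length (reverse xs)
    lengths = trans (length-reverse X) (trans (ℕₚ.suc-injective e) (sym (length-reverse xs)))
    last : ∀ b → reverse (select (b ∷ X) (x ∷ xs)) ≡ select (reverse X) (reverse xs) ++ select [ b ] [ x ]
    last true  = trans (unfold-reverse x (select X xs)) (cong (_++ [ x ]) (reverse-select X xs (ℕₚ.suc-injective e)))
    last false = trans (reverse-select X xs (ℕₚ.suc-injective e)) (sym (++-identityʳ _))

  select-self : ∀ {a} {A : Set a} (p : A → Bool) xs → select (map p xs) xs ≡ filterᵇ p xs
  select-self p []       = refl
  select-self p (x ∷ xs) with p x
  ... | true  = cong (x ∷_) (select-self p xs)
  ... | false = select-self p xs

  trues : List Bool → ℕ
  trues []          = 0
  trues (true ∷ X)  = suc (trues X)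
  trues (false ∷ X) = trues X

  trues-++ : ∀ X Y → trues (X ++ Y) ≡ trues X + trues Y
  trues-++ []          Y = refl
  trues-++ (true ∷ X)  Y = cong suc (trues-++ X Y)
  trues-++ (false ∷ X) Y = trues-++ X Y

  trues-∷ʳ : ∀ b X → trues (X ++ [ b ]) ≡ trues (b ∷ X)
  trues-∷ʳ b X = trans (trues-++ X [ b ]) (single b)
    where
    single : ∀ b → trues X + trues [ b ] ≡ trues (b ∷ X)
    single true  = ℕₚ.+-comm (trues X) 1
    single false = +-identityʳ (trues X)

  trues-reverse : ∀ X → trues (reverse X) ≡ trues X
  trues-reverse []      = refl
  trues-reverse (b ∷ X) = begin
    trues (reverse (b ∷ X))     ≡⟨ cong trues (unfold-reverse b X) ⟩
    trues (reverse X ++ [ b ])  ≡⟨ trues-++ (reverse X) [ b ] ⟩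
    trues (reverse X) + trues [ b ] ≡⟨ cong (_+ trues [ b ]) (trues-reverse X) ⟩
    trues X + trues [ b ]       ≡⟨ sym (trues-++ X [ b ]) ⟩
    trues (X ++ [ b ])          ≡⟨ trues-∷ʳ b X ⟩
    trues (b ∷ X)               ∎
    where open ≡-Reasoning

  trues-∷ : ∀ b X → trues (b ∷ X) ≡ trues [ b ] + trues X
  trues-∷ true  X = refl
  trues-∷ false X = refl

  trues-map-≤ : ∀ {a} {A : Set a} (p : A → Bool) xs → trues (map p xs) ≤ length xs
  trues-map-≤ p []       = z≤n
  trues-map-≤ p (x ∷ xs) with p x
  ... | true  = s≤s (trues-map-≤ p xs)
  ... | false = ℕₚ.m≤n⇒m≤1+n (trues-map-≤ p xs)

  ≡ᵇ-refl : ∀ m → (m ≡ᵇ m) ≡ true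
  ≡ᵇ-refl zero    = refl
  ≡ᵇ-refl (suc m) = ≡ᵇ-refl m

  ≢⇒≡ᵇ≡false : ∀ {m n} → m ≢ n → (m ≡ᵇ n) ≡ false
  ≢⇒≡ᵇ≡false {zero}  {zero}  ne = ⊥-elim (ne refl)
  ≢⇒≡ᵇ≡false {zero}  {suc n} ne = refl
  ≢⇒≡ᵇ≡false {suc m} {zero}  ne = refl
  ≢⇒≡ᵇ≡false {suc m} {suc n} ne = ≢⇒≡ᵇ≡false (ne ∘ cong suc)

  All-range : ∀ {p} {P : ℕ → Set p} s m → (∀ i → i < m → P (s + i)) → All P (range s m)
  All-range s zero    h = []
  All-range {P = P} s (suc m) h = subst P (+-identityʳ s) (h 0 (s≤s z≤n))
                            ∷ All-range (suc s) m (λ i i<m → subst P (+-suc s i) (h (suc i) (s≤s i<m)))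

  bitAt : List Bool → ℕ → Bool
  bitAt []      _       = false
  bitAt (b ∷ L) zero    = b
  bitAt (b ∷ L) (suc i) = bitAt L i

  bitAt-length-++ : ∀ Z b Y → bitAt (Z ++ b ∷ Y) (length Z) ≡ b
  bitAt-length-++ []      b Y = refl
  bitAt-length-++ (_ ∷ Z) b Y = bitAt-length-++ Z b Y

  bitAt-map-range : ∀ (f : ℕ → Bool) s m i → i < m → bitAt (map f (range s m)) i ≡ f (s + i)
  bitAt-map-range f s (suc m) zero    _         = cong f (sym (+-identityʳ s))
  bitAt-map-range f s (suc m) (suc i) (s≤s i<m) = trans (bitAt-map-range f (suc s) m i i<m) (cong f (sym (+-suc s i)))

  map-bitAt-range : ∀ L → map (bitAt L) (range 0 (length L)) ≡ L
  map-bitAt-range []      = refl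
  map-bitAt-range (b ∷ L) = cong (b ∷_) (trans (map-range-cong 1 0 (length L) (λ _ _ → refl)) (map-bitAt-range L))

  toSubset : (n : ℕ) → List Bool → Subset n
  toSubset zero    _       = Vec.[]
  toSubset (suc n) []      = false Vec.∷ toSubset n []
  toSubset (suc n) (b ∷ L) = b Vec.∷ toSubset n L

  lookup-toSubset : ∀ n L (i : Fin n) → lookup (toSubset n L) i ≡ bitAt L (toℕ i)
  lookup-toSubset (suc n) []      Fin.zero    = refl
  lookup-toSubset (suc n) []      (Fin.suc i) = lookup-toSubset n [] i
  lookup-toSubset (suc n) (b ∷ L) Fin.zero    = refl
  lookup-toSubset (suc n) (b ∷ L) (Fin.suc i) = lookup-toSubset n L i

  ∣toSubset∣ : ∀ n L → length L ≡ n → ∣ toSubset n L ∣ ≡ trues L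
  ∣toSubset∣ zero    []          _ = refl
  ∣toSubset∣ (suc n) (true ∷ L)  e = cong suc (∣toSubset∣ n L (ℕₚ.suc-injective e))
  ∣toSubset∣ (suc n) (false ∷ L) e = ∣toSubset∣ n L (ℕₚ.suc-injective e)

module Sums {c ℓ : Level} (R : Ring c ℓ) where
  open Ring R hiding (zero)
  open import Algebra.Properties.CommutativeSemigroup +-commutativeSemigroup using (interchange)
  open import Algebra.Definitions.RawMonoid +-rawMonoid using () renaming (_×_ to _×ₙ_) public
  open import Relation.Binary.Reasoning.Setoid setoid

  ∑ : List Carrier → Carrier
  ∑ = sum R

  ∏ : List Carrier → Carrier
  ∏ = prod R

  sum-++ : ∀ xs ys → ∑ (xs ++ ys) ≈ ∑ xs + ∑ ys
  sum-++ []       ys = sym (+-identityˡ _)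
  sum-++ (x ∷ xs) ys = trans (+-congˡ (sum-++ xs ys)) (sym (+-assoc _ _ _))

  prod-++ : ∀ xs ys → ∏ (xs ++ ys) ≈ ∏ xs * ∏ ys
  prod-++ []       ys = sym (*-identityˡ _)
  prod-++ (x ∷ xs) ys = trans (*-congˡ (prod-++ xs ys)) (sym (*-assoc _ _ _))

  sum-map-range-cong : ∀ (f g : ℕ → Carrier) s m → (∀ i → i < m → f (s ℕ.+ i) ≈ g (s ℕ.+ i)) →
                       ∑ (map f (range s m)) ≈ ∑ (map g (range s m))
  sum-map-range-cong f g s zero    e = refl
  sum-map-range-cong f g s (suc m) e = +-cong (head (e 0 (s≤s z≤n)))
    (sum-map-range-cong f g (suc s) m (λ i i<m → tail i (e (suc i) (s≤s i<m))))
    where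
    head : f (s ℕ.+ 0) ≈ g (s ℕ.+ 0) → f s ≈ g s
    head = ≡.subst (λ t → f t ≈ g t) (ℕₚ.+-identityʳ s)
    tail : ∀ i → f (s ℕ.+ suc i) ≈ g (s ℕ.+ suc i) → f (suc s ℕ.+ i) ≈ g (suc s ℕ.+ i)
    tail i = ≡.subst (λ t → f t ≈ g t) (ℕₚ.+-suc s i)

  *-sum-map : ∀ {a} {A : Set a} x (f : A → Carrier) xs → x * ∑ (map f xs) ≈ ∑ (map (λ y → x * f y) xs)
  *-sum-map x f []       = zeroʳ x
  *-sum-map x f (y ∷ ys) = trans (distribˡ x _ _) (+-congˡ (*-sum-map x f ys))

  sum-map-filter : ∀ {a p} {A : Set a} {P : A → Set p} (P? : Relation.Unary.Decidable P) (f : A → Carrier) xs →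
                   ∑ (map f (filter P? xs)) ≈ ∑ (map (λ x → if does (P? x) then f x else 0#) xs)
  sum-map-filter P? f []       = refl
  sum-map-filter P? f (x ∷ xs) with does (P? x)
  ... | true  = +-congˡ (sum-map-filter P? f xs)
  ... | false = trans (sum-map-filter P? f xs) (sym (+-identityˡ _))

  sum-if-trues : ∀ bs x → ∑ (map (λ b → if b then x else 0#) bs) ≈ trues bs ×ₙ x
  sum-if-trues []          x = refl
  sum-if-trues (true ∷ bs) x = +-congˡ (sum-if-trues bs x)
  sum-if-trues (false ∷ bs) x = trans (+-identityˡ _) (sum-if-trues bs x)

  *-if : ∀ (p : Bool) x y → x * (if p then y else 0#) ≈ (if p then x * y else 0#)
  *-if true  x y = refl
  *-if false x y = zeroʳ x

  *-comm-prod : ∀ x ys → All (λ y → x * y ≈ y * x) ys → x * ∏ ys ≈ ∏ ys * x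
  *-comm-prod x []       []       = trans (*-identityʳ x) (sym (*-identityˡ x))
  *-comm-prod x (y ∷ ys) (xy ∷ cs) = begin
    x * (y * ∏ ys)   ≈⟨ sym (*-assoc x y _) ⟩
    (x * y) * ∏ ys   ≈⟨ *-congʳ xy ⟩
    (y * x) * ∏ ys   ≈⟨ *-assoc y x _ ⟩
    y * (x * ∏ ys)   ≈⟨ *-congˡ (*-comm-prod x ys cs) ⟩
    y * (∏ ys * x)   ≈⟨ sym (*-assoc y _ x) ⟩
    (y * ∏ ys) * x   ∎

  prod-comm-prod : ∀ xs ys → All (λ x → All (λ y → x * y ≈ y * x) ys) xs → ∏ xs * ∏ ys ≈ ∏ ys * ∏ xs
  prod-comm-prod []       ys []        = trans (*-identityˡ _) (sym (*-identityʳ _))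
  prod-comm-prod (x ∷ xs) ys (cx ∷ cs) = begin
    (x * ∏ xs) * ∏ ys  ≈⟨ *-assoc x _ _ ⟩
    x * (∏ xs * ∏ ys)  ≈⟨ *-congˡ (prod-comm-prod xs ys cs) ⟩
    x * (∏ ys * ∏ xs)  ≈⟨ sym (*-assoc x _ _) ⟩
    (x * ∏ ys) * ∏ xs  ≈⟨ *-congʳ (*-comm-prod x ys cx) ⟩
    (∏ ys * x) * ∏ xs  ≈⟨ *-assoc _ x _ ⟩
    ∏ ys * (x * ∏ xs)  ∎

  if-cong : ∀ (p : Bool) {x y} → x ≈ y → (if p then x else 0#) ≈ (if p then y else 0#)
  if-cong true  e = e
  if-cong false e = refl

  ∑masks : ℕ → (List Bool → Carrier) → Carrier
  ∑masks zero    f = f []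
  ∑masks (suc m) f = ∑masks m (λ X → f (false ∷ X)) + ∑masks m (λ X → f (true ∷ X))

  ∑masks-cong : ∀ m {f g : List Bool → Carrier} → (∀ X → length X ≡ m → f X ≈ g X) → ∑masks m f ≈ ∑masks m g
  ∑masks-cong zero    e = e [] ≡.refl
  ∑masks-cong (suc m) e = +-cong (∑masks-cong m (λ X l → e (false ∷ X) (≡.cong suc l)))
                                 (∑masks-cong m (λ X l → e (true ∷ X) (≡.cong suc l)))

  ∑masks-≡ : ∀ {m n} → m ≡ n → (f : List Bool → Carrier) → ∑masks m f ≈ ∑masks n f
  ∑masks-≡ ≡.refl f = refl

  ∑masks-+ : ∀ m (f g : List Bool → Carrier) → ∑masks m (λ X → f X + g X) ≈ ∑masks m f + ∑masks m g
  ∑masks-+ zero    f g = refl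
  ∑masks-+ (suc m) f g = trans (+-cong (∑masks-+ m _ _) (∑masks-+ m _ _)) (interchange _ _ _ _)

  ∑masks-0 : ∀ m → ∑masks m (λ _ → 0#) ≈ 0#
  ∑masks-0 zero    = refl
  ∑masks-0 (suc m) = trans (+-cong (∑masks-0 m) (∑masks-0 m)) (+-identityˡ 0#)

  *-∑masks : ∀ m x (f : List Bool → Carrier) → x * ∑masks m f ≈ ∑masks m (λ X → x * f X)
  *-∑masks zero    x f = refl
  *-∑masks (suc m) x f = trans (distribˡ x _ _) (+-cong (*-∑masks m x _) (*-∑masks m x _))

  ∑masks-* : ∀ m x (f : List Bool → Carrier) → ∑masks m f * x ≈ ∑masks m (λ X → f X * x)
  ∑masks-* zero    x f = refl
  ∑masks-* (suc m) x f = trans (distribʳ x _ _) (+-cong (∑masks-* m x _) (∑masks-* m x _))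

  ∑masks-++ : ∀ p q (f : List Bool → Carrier) → ∑masks (p ℕ.+ q) f ≈ ∑masks p (λ Y → ∑masks q (λ Z → f (Y ++ Z)))
  ∑masks-++ zero    q f = refl
  ∑masks-++ (suc p) q f = +-cong (∑masks-++ p q _) (∑masks-++ p q _)

  ∑masks-∷ʳ : ∀ m (f : List Bool → Carrier) → ∑masks (suc m) f ≈ ∑masks m (λ Y → f (Y ++ [ false ])) + ∑masks m (λ Y → f (Y ++ [ true ]))
  ∑masks-∷ʳ m f = trans (∑masks-≡ (ℕₚ.+-comm 1 m) f) (trans (∑masks-++ m 1 f) (∑masks-+ m _ _))

  ∑masks-reverse : ∀ m (f : List Bool → Carrier) → ∑masks m (f ∘ reverse) ≈ ∑masks m f
  ∑masks-reverse zero    f = refl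
  ∑masks-reverse (suc m) f = begin
    ∑masks m (λ X → f (reverse (false ∷ X))) + ∑masks m (λ X → f (reverse (true ∷ X)))
      ≈⟨ +-cong (∑masks-cong m (λ X _ → reflexive (≡.cong f (unfold-reverse false X))))
                (∑masks-cong m (λ X _ → reflexive (≡.cong f (unfold-reverse true X)))) ⟩
    ∑masks m (λ X → f (reverse X ++ [ false ])) + ∑masks m (λ X → f (reverse X ++ [ true ]))
      ≈⟨ +-cong (∑masks-reverse m (λ Y → f (Y ++ [ false ]))) (∑masks-reverse m (λ Y → f (Y ++ [ true ]))) ⟩
    ∑masks m (λ Y → f (Y ++ [ false ])) + ∑masks m (λ Y → f (Y ++ [ true ]))
      ≈⟨ sym (∑masks-∷ʳ m f) ⟩
    ∑masks (suc m) f ∎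

  sum-map-∑masks : ∀ {a} {A : Set a} m (g : A → List Bool → Carrier) xs →
                   ∑ (map (λ x → ∑masks m (g x)) xs) ≈ ∑masks m (λ X → ∑ (map (λ x → g x X) xs))
  sum-map-∑masks m g []       = sym (∑masks-0 m)
  sum-map-∑masks m g (x ∷ xs) = trans (+-congˡ (sum-map-∑masks m g xs)) (sym (∑masks-+ m _ _))

  sum-allSubsets : ∀ n (f : Subset n → Carrier) → ∑ (map f (allSubsets n)) ≈ ∑masks n (f ∘ toSubset n)
  sum-allSubsets zero    f = +-identityʳ _
  sum-allSubsets (suc n) f = begin
    ∑ (map f (allSubsets (suc n)))                             ≈⟨ pairs (allSubsets n) ⟩
    ∑ (map (λ s → f (false Vec.∷ s) + f (true Vec.∷ s)) (allSubsets n)) ≈⟨ sum-allSubsets n _ ⟩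
    ∑masks n (λ L → f (false Vec.∷ toSubset n L) + f (true Vec.∷ toSubset n L)) ≈⟨ ∑masks-+ n _ _ ⟩
    ∑masks (suc n) (f ∘ toSubset (suc n))                     ∎
    where
    pairs : ∀ ss → ∑ (map f (concatMap (λ s → (false Vec.∷ s) ∷ (true Vec.∷ s) ∷ []) ss))
                 ≈ ∑ (map (λ s → f (false Vec.∷ s) + f (true Vec.∷ s)) ss)
    pairs []       = refl
    pairs (s ∷ ss) = trans (+-congˡ (+-congˡ (pairs ss))) (sym (+-assoc _ _ _))

  prod-map-+1 : ∀ {a} {A : Set a} (t : A → Carrier) ys →
                ∏ (map (λ y → t y + 1#) ys) ≈ ∑masks (length ys) (λ X → ∏ (map t (select X ys)))
  prod-map-+1 t []       = refl
  prod-map-+1 t (y ∷ ys) = begin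
    (t y + 1#) * ∏ (map (λ y → t y + 1#) ys) ≈⟨ *-congˡ (prod-map-+1 t ys) ⟩
    (t y + 1#) * S                           ≈⟨ distribʳ S (t y) 1# ⟩
    t y * S + 1# * S                         ≈⟨ +-comm _ _ ⟩
    1# * S + t y * S                         ≈⟨ +-cong (*-identityˡ S) (*-∑masks (length ys) (t y) _) ⟩
    S + ∑masks (length ys) (λ X → t y * ∏ (map t (select X ys))) ∎
    where
    S : Carrier
    S = ∑masks (length ys) (λ X → ∏ (map t (select X ys)))

  sum-map-choose : ∀ {A : Set} n (h : List A → Carrier) xs →
                   ∑ (map h (choose n xs)) ≈ ∑masks (length xs) (λ X → if trues X ≡ᵇ n then h (select X xs) else 0#)
  sum-map-choose zero    h []       = +-identityʳ _
  sum-map-choose zero    h (x ∷ xs) = trans (sum-map-choose zero h xs) (sym (trans (+-congˡ (∑masks-0 (length xs))) (+-identityʳ _)))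
  sum-map-choose (suc n) h []       = refl
  sum-map-choose (suc n) h (x ∷ xs) = begin
    ∑ (map h (map (x ∷_) (choose n xs) ++ choose (suc n) xs))      ≡⟨ ≡.cong ∑ (map-++ h (map (x ∷_) (choose n xs)) (choose (suc n) xs)) ⟩
    ∑ (map h (map (x ∷_) (choose n xs)) ++ map h (choose (suc n) xs)) ≈⟨ sum-++ (map h (map (x ∷_) (choose n xs))) _ ⟩
    ∑ (map h (map (x ∷_) (choose n xs))) + ∑ (map h (choose (suc n) xs)) ≡⟨ ≡.cong (λ t → ∑ t + _) (≡.sym (map-∘ (choose n xs))) ⟩
    ∑ (map (h ∘ (x ∷_)) (choose n xs)) + ∑ (map h (choose (suc n) xs)) ≈⟨ +-cong (sum-map-choose n (h ∘ (x ∷_)) xs) (sum-map-choose (suc n) h xs) ⟩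
    _ + _                                                          ≈⟨ +-comm _ _ ⟩
    _                                                              ∎

module Residues (k : ℕ) where
  open import Data.Integer using (+_)
  open import Data.Nat using (_+_; _*_)
  open import Data.Nat.Properties
  open import Data.Nat.DivMod
  open import Data.Fin.Properties using (toℕ-fromℕ<; toℕ-injective)
  open import Data.Integer.DivMod using (_%ℕ_; _/ℕ_; a≡a%ℕn+[a/ℕn]*n; n%ℕd<d)
  import Data.Integer.Properties as ℤₚ
  open import Data.Integer.Tactic.RingSolver using (solve-∀)
  open ≡ hiding ([_])

  n : ℕ
  n = suc k

  toℕ-mod : ∀ x → toℕ (x mod n) ≡ x % n
  toℕ-mod x = toℕ-fromℕ< _

  mod-cong : ∀ x y → x % n ≡ y % n → x mod n ≡ y mod n
  mod-cong x y e = toℕ-injective (trans (toℕ-mod x) (trans e (sym (toℕ-mod y))))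

  %-+ : ∀ a b → (a % n + b) % n ≡ (a + b) % n
  %-+ a b = begin
    (a % n + b) % n           ≡⟨ %-distribˡ-+ (a % n) b n ⟩
    (a % n % n + b % n) % n   ≡⟨ cong (λ t → (t + b % n) % n) (m%n%n≡m%n a n) ⟩
    (a % n + b % n) % n       ≡⟨ sym (%-distribˡ-+ a b n) ⟩
    (a + b) % n               ∎
    where open ≡-Reasoning

  %-cong-+ : ∀ x y i → x % n ≡ y % n → (x + i) % n ≡ (y + i) % n
  %-cong-+ x y i e = trans (sym (%-+ x i)) (trans (cong (λ t → (t + i) % n) e) (%-+ y i))

  next-mod : ∀ x → next (x mod n) ≡ suc x mod n
  next-mod x = mod-cong (suc (toℕ (x mod n))) (suc x)
    (trans (cong (λ t → suc t % n) (toℕ-mod x)) (trans (cong (_% n) (+-comm 1 (x % n))) (trans (%-+ x 1) (cong (_% n) (+-comm x 1)))))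

  %-+-≢ : ∀ x e → 0 < e → e < n → x % n ≢ (x + e) % n
  %-+-≢ x e 0<e e<n eq with x % n + e <? n
  ... | yes lt = <⇒≢ (m<m+n (x % n) 0<e) (trans eq (trans (sym (%-+ x e)) (m<n⇒m%n≡m lt)))
  ... | no ≮ = <⇒≢ e<n (+-cancelˡ-≡ (x % n) e n (trans (sym (m∸n+n≡m n≤r+e)) (cong (_+ n) (sym r≡r+e∸n))))
    where
    r : ℕ
    r = x % n
    n≤r+e : n ≤ r + e
    n≤r+e = ≮⇒≥ ≮
    r+e∸n<n : r + e ∸ n < n
    r+e∸n<n = +-cancelʳ-< _ _ n (subst (_< n + n) (sym (m∸n+n≡m n≤r+e)) (+-mono-< (m%n<n x n) e<n))
    r≡r+e∸n : r ≡ r + e ∸ n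
    r≡r+e∸n = trans (trans eq (sym (%-+ x e))) (trans (sym (m≤n⇒[n∸m]%m≡n%m n≤r+e)) (m<n⇒m%n≡m r+e∸n<n))

  far-mod : ∀ x e → 2 ≤ e → e < k → Far (x mod n) ((x + e) mod n)
  far-mod x e 2≤e e<k = apart , apart-next , next-apart
    where
    toℕ-≢ : ∀ {i j} → toℕ i ≢ toℕ j → i ≢ j
    toℕ-≢ ne = ne ∘ cong toℕ
    apart : x mod n ≢ (x + e) mod n
    apart = toℕ-≢ (subst₂ _≢_ (sym (toℕ-mod x)) (sym (toℕ-mod (x + e)))
              (%-+-≢ x e (≤-trans (s≤s z≤n) 2≤e) (≤-trans e<k (n≤1+n k))))
    apart-next : x mod n ≢ next ((x + e) mod n)
    apart-next eq = %-+-≢ x (suc e) (s≤s z≤n) (s≤s e<k)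
      (trans (sym (toℕ-mod x)) (trans (cong toℕ (trans eq (next-mod (x + e)))) (trans (toℕ-mod (suc (x + e))) (cong (_% n) (sym (+-suc x e))))))
    next-apart : (x + e) mod n ≢ next (x mod n)
    next-apart eq = %-+-≢ (suc x) (e ∸ 1) (∸-monoˡ-≤ 1 2≤e) (s≤s (≤-trans (m∸n≤m e 1) (<⇒≤ e<k)))
      (sym (trans (cong (_% n) x+1+[e∸1]≡x+e) (trans (sym (toℕ-mod (x + e))) (trans (cong toℕ (trans eq (next-mod x))) (toℕ-mod (suc x))))))
      where
      x+1+[e∸1]≡x+e : suc x + (e ∸ 1) ≡ x + e
      x+1+[e∸1]≡x+e = trans (sym (+-suc x (e ∸ 1))) (cong (λ t → x + t) (m+[n∸m]≡n {1} {e} (≤-trans (s≤s z≤n) 2≤e)))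

  remainder-unique : ∀ r₁ r₂ q₁ q₂ → r₁ < n → r₂ < n → + r₁ ℤ.+ q₁ ℤ.* + n ≡ + r₂ ℤ.+ q₂ ℤ.* + n → r₁ ≡ r₂
  remainder-unique r₁ r₂ q₁ q₂ r₁<n r₂<n eq = ℤₚ.+-injective (ℤₚ.i-j≡0⇒i≡j (+ r₁) (+ r₂) (ℤₚ.∣i∣≡0⇒i≡0 d≡0))
    where
    diff : + r₁ ℤ.- + r₂ ≡ (q₂ ℤ.- q₁) ℤ.* + n
    diff = begin
      + r₁ ℤ.- + r₂                                       ≡⟨ shift (+ r₁) (+ r₂) (q₁ ℤ.* + n) ⟩
      (+ r₁ ℤ.+ q₁ ℤ.* + n) ℤ.- (+ r₂ ℤ.+ q₁ ℤ.* + n)    ≡⟨ cong (ℤ._- (+ r₂ ℤ.+ q₁ ℤ.* + n)) eq ⟩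
      (+ r₂ ℤ.+ q₂ ℤ.* + n) ℤ.- (+ r₂ ℤ.+ q₁ ℤ.* + n)    ≡⟨ factor (+ r₂) q₂ q₁ (+ n) ⟩
      (q₂ ℤ.- q₁) ℤ.* + n                                 ∎
      where
      open ≡-Reasoning
      shift : ∀ (a b c : ℤ) → a ℤ.- b ≡ (a ℤ.+ c) ℤ.- (b ℤ.+ c)
      shift = solve-∀
      factor : ∀ (r q₂ q₁ m : ℤ) → (r ℤ.+ q₂ ℤ.* m) ℤ.- (r ℤ.+ q₁ ℤ.* m) ≡ (q₂ ℤ.- q₁) ℤ.* m
      factor = solve-∀
    d : ℕ
    d = ℤ.∣ + r₁ ℤ.- + r₂ ∣
    d<n : d < n
    d<n = subst (_< n) (sym (cong ℤ.∣_∣ (ℤₚ.[+m]-[+n]≡m⊖n r₁ r₂))) (≤-<-trans (ℤₚ.∣m⊝n∣≤m⊔n r₁ r₂) (⊔-lub r₁<n r₂<n))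
    d≡0 : d ≡ 0
    d≡0 with ℤ.∣ q₂ ℤ.- q₁ ∣ | trans (cong ℤ.∣_∣ diff) (ℤₚ.abs-* (q₂ ℤ.- q₁) (+ n))
    ... | zero  | e = e
    ... | suc t | e = ⊥-elim (<⇒≱ d<n (subst (n ≤_) (sym e) (m≤m+n n (t * n))))

  %ℕ-+ : ∀ z j → (z ℤ.+ + j) %ℕ n ≡ (z %ℕ n + j) % n
  %ℕ-+ z j = remainder-unique _ _ ((z ℤ.+ + j) /ℕ n) (q ℤ.+ + t) (n%ℕd<d (z ℤ.+ + j) n) (m%n<n (r + j) n) eq
    where
    r s t : ℕ
    r = z %ℕ n
    s = (r + j) % n
    t = (r + j) / n
    q : ℤ
    q = z /ℕ n
    r+j : + (r + j) ≡ + s ℤ.+ + t ℤ.* + n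
    r+j = trans (cong +_ (m≡m%n+[m/n]*n (r + j) n)) (trans (ℤₚ.pos-+ s (t * n)) (cong (λ u → + s ℤ.+ u) (ℤₚ.pos-* t n)))
    regroup₁ : ∀ (r q m j : ℤ) → (r ℤ.+ q ℤ.* m) ℤ.+ j ≡ (r ℤ.+ j) ℤ.+ q ℤ.* m
    regroup₁ = solve-∀
    regroup₂ : ∀ (s t m q : ℤ) → (s ℤ.+ t ℤ.* m) ℤ.+ q ℤ.* m ≡ s ℤ.+ (q ℤ.+ t) ℤ.* m
    regroup₂ = solve-∀
    eq : + ((z ℤ.+ + j) %ℕ n) ℤ.+ ((z ℤ.+ + j) /ℕ n) ℤ.* + n ≡ + s ℤ.+ (q ℤ.+ + t) ℤ.* + n
    eq = begin
      + ((z ℤ.+ + j) %ℕ n) ℤ.+ ((z ℤ.+ + j) /ℕ n) ℤ.* + n ≡⟨ sym (a≡a%ℕn+[a/ℕn]*n (z ℤ.+ + j) n) ⟩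
      z ℤ.+ + j                                             ≡⟨ cong (ℤ._+ + j) (a≡a%ℕn+[a/ℕn]*n z n) ⟩
      (+ r ℤ.+ q ℤ.* + n) ℤ.+ + j                           ≡⟨ regroup₁ (+ r) q (+ n) (+ j) ⟩
      (+ r ℤ.+ + j) ℤ.+ q ℤ.* + n                           ≡⟨ cong (ℤ._+ q ℤ.* + n) (trans (sym (ℤₚ.pos-+ r j)) r+j) ⟩
      (+ s ℤ.+ + t ℤ.* + n) ℤ.+ q ℤ.* + n                   ≡⟨ regroup₂ (+ s) (+ t) (+ n) q ⟩
      + s ℤ.+ (q ℤ.+ + t) ℤ.* + n                           ∎
      where open ≡-Reasoning

  𝔯-shift : ∀ z j → ((z ℤ.+ + j) %ℕ n) mod n ≡ (z %ℕ n + j) mod n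
  𝔯-shift z j = mod-cong ((z ℤ.+ + j) %ℕ n) (z %ℕ n + j) (trans (cong (_% n) (%ℕ-+ z j)) (m%n%n≡m%n (z %ℕ n + j) n))

  pos-∸ : ∀ a b → b ≤ a → + (a ∸ b) ≡ + a ℤ.- + b
  pos-∸ a b b≤a = sym (trans (ℤₚ.[+m]-[+n]≡m⊖n a b) (ℤₚ.⊖-≥ b≤a))

  -- 𝔯 reverses order, so it sends the decreasing run lo+m-1, …, lo to a run of consecutive residues.
  𝔯-reverse-run : ∀ lo m → map (𝔯 k) (reverse (map (λ i → lo ℤ.+ + i) (upTo m)))
                         ≡ map (_mod n) (range ((+ 2 ℤ.- (lo ℤ.+ + m)) %ℕ n) m)
  𝔯-reverse-run lo m = begin
    map (𝔯 k) (reverse (map (λ i → lo ℤ.+ + i) (upTo m)))  ≡⟨ cong (λ xs → map (𝔯 k) (reverse (map (λ i → lo ℤ.+ + i) xs)))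
                                                                    (upTo≡range m) ⟩
    map (𝔯 k) (reverse (map (λ i → lo ℤ.+ + i) (range 0 m))) ≡⟨ cong (map (𝔯 k)) (reverse-map-range (λ i → lo ℤ.+ + i) m) ⟩
    map (𝔯 k) (map (λ j → lo ℤ.+ + (m ∸ suc j)) (range 0 m)) ≡⟨ sym (map-∘ (range 0 m)) ⟩
    map (λ j → 𝔯 k (lo ℤ.+ + (m ∸ suc j))) (range 0 m)      ≡⟨ map-range-cong 0 0 m 𝔯-at ⟩
    map (λ j → (c + j) mod n) (range 0 m)                    ≡⟨ map-range-+ (_mod n) c 0 m ⟩
    map (_mod n) (range (c + 0) m)                           ≡⟨ cong (λ s → map (_mod n) (range s m)) (+-identityʳ c) ⟩
    map (_mod n) (range c m)                                 ∎
    where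
    open ≡-Reasoning
    c : ℕ
    c = (+ 2 ℤ.- (lo ℤ.+ + m)) %ℕ n
    regroup : ∀ (lo m j : ℤ) → + 1 ℤ.- (lo ℤ.+ (m ℤ.- (+ 1 ℤ.+ j))) ≡ (+ 2 ℤ.- (lo ℤ.+ m)) ℤ.+ j
    regroup = solve-∀
    𝔯-at : ∀ j → j < m → 𝔯 k (lo ℤ.+ + (m ∸ suc j)) ≡ (c + j) mod n
    𝔯-at j j<m = trans (cong (λ u → ((+ 1 ℤ.- (lo ℤ.+ u)) %ℕ n) mod n) (pos-∸ m (suc j) j<m))
                   (trans (cong (λ u → (u %ℕ n) mod n) (regroup lo (+ m) (+ j))) (𝔯-shift (+ 2 ℤ.- (lo ℤ.+ + m)) j))

module Words (k : ℕ) {c ℓ : Level} (R : Ring c ℓ) (T : Fin (suc k) → Ring.Carrier R) where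
  open Ring R using (Carrier; _*_; _≈_; setoid; refl; sym; trans; reflexive; *-congˡ; *-congʳ)
  open Sums R
  open Residues k
  open import Data.Nat using (_+_)
  open import Data.Nat.Properties using (+-identityʳ; +-suc; +-assoc; +-comm; m+[n∸m]≡n; m∸n≤m; ≤-total; <-cmp; m≤n+m; +-mono-≤)
  open import Data.Nat.DivMod using (_mod_; _%_; [m+n]%n≡m%n)
  open import Data.Nat.Induction using (<-rec)
  open import Relation.Binary.Definitions using (tri<; tri≈; tri>)
  open import Data.Nat.Tactic.RingSolver using (solve-∀)
  open import Data.List.Relation.Unary.All.Properties using (map⁺; filter⁺)
  open import Relation.Binary.Reasoning.Setoid setoid

  Tmod : ℕ → Carrier
  Tmod x = T (x mod n)

  Tmod-periodic : ∀ x → Tmod (x + n) ≡ Tmod x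
  Tmod-periodic x = ≡.cong T (mod-cong (x + n) x ([m+n]%n≡m%n x n))

  prod-Tmod-++ : ∀ xs ys → ∏ (map Tmod (xs ++ ys)) ≈ ∏ (map Tmod xs) * ∏ (map Tmod ys)
  prod-Tmod-++ xs ys = trans (reflexive (≡.cong ∏ (map-++ Tmod xs ys))) (prod-++ (map Tmod xs) (map Tmod ys))

  Tmod-cong : ∀ x y → x % n ≡ y % n → Tmod x ≡ Tmod y
  Tmod-cong x y e = ≡.cong T (mod-cong x y e)

  word : List Bool → List ℕ → Carrier
  word X xs = ∏ (map Tmod (select X xs))

  word-++ : ∀ Y X xs ys → length Y ≡ length xs → word (Y ++ X) (xs ++ ys) ≈ word Y xs * word X ys
  word-++ Y X xs ys len = trans (reflexive (≡.cong (∏ ∘ map Tmod) (select-++ Y xs X ys len)))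
                                (prod-Tmod-++ (select Y xs) (select X ys))

  word-range-≡ : ∀ X x y m → x % n ≡ y % n → word X (range x m) ≡ word X (range y m)
  word-range-≡ X x y m e = ≡.cong ∏ (≡.trans (≡.sym (select-map Tmod X (range x m)))
    (≡.trans (≡.cong (select X) (map-range-cong x y m (λ i _ → Tmod-cong (x + i) (y + i) (%-cong-+ x y i e))))
             (select-map Tmod X (range y m))))

  module Windows (commute : ∀ i j → Far i j → T i * T j ≈ T j * T i)
                 (f : ℕ → Bool) (f-periodic : ∀ x → f (x + n) ≡ f x) where

    Commute : ℕ → ℕ → Set ℓ
    Commute x y = Tmod x * Tmod y ≈ Tmod y * Tmod x

    commute-far : ∀ x d → 2 ≤ d → d < k → Commute x (x + d)
    commute-far x d 2≤d d<k = commute (x mod n) ((x + d) mod n) (far-mod x d 2≤d d<k)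

    window : ℕ → Carrier
    window s = ∏ (map Tmod (filterᵇ f (range s k)))

    window-periodic : ∀ s → window (s + n) ≈ window s
    window-periodic s = reflexive (≡.cong ∏ (map-filterᵇ-range-cong f f Tmod Tmod (s + n) s k
      (λ i _ → ≡.trans (≡.cong f (shift i)) (f-periodic (s + i)))
      (λ i _ → ≡.trans (≡.cong Tmod (shift i)) (Tmod-periodic (s + i)))))
      where
      shift : ∀ i → s + n + i ≡ s + i + n
      shift i = ≡.trans (+-assoc s n i) (≡.trans (≡.cong (λ j → s + j) (+-comm n i)) (≡.sym (+-assoc s i n)))

    -- The run of generators at the front of the window commutes past the rest, which is
    -- the window starting after the run with the run reappearing (one period later) at its end.
    window-skip-run : ∀ s e → e < k → (∀ i → i < e → f (s + i) ≡ true) → f (s + e) ≡ false → f (s + k) ≡ false →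
                      window s ≈ window (s + suc e)
    window-skip-run s e e<k run fe fk = begin
      window s                                   ≡⟨ ≡.cong (∏ ∘ map Tmod) front ⟩
      ∏ (map Tmod (range s e ++ rest))           ≈⟨ prod-Tmod-++ (range s e) rest ⟩
      ∏ (map Tmod (range s e)) * ∏ (map Tmod rest) ≈⟨ prod-comm-prod _ _ (map⁺ (All-range s e (λ i i<e → map⁺ (filter⁺ (T? ∘ f)
                                                        (All-range (suc (s + e)) q (λ j j<q → run-commutes-rest i i<e j j<q)))))) ⟩
      ∏ (map Tmod rest) * ∏ (map Tmod (range s e)) ≈⟨ *-congˡ (reflexive (≡.cong ∏ (≡.sym wrapped))) ⟩
      ∏ (map Tmod rest) * ∏ (map Tmod (filterᵇ f (range (suc (s + k)) e))) ≈⟨ sym (prod-Tmod-++ rest _) ⟩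
      ∏ (map Tmod (rest ++ filterᵇ f (range (suc (s + k)) e))) ≡⟨ ≡.cong (∏ ∘ map Tmod) (≡.sym back) ⟩
      window (s + suc e)                         ∎
      where
      q : ℕ
      q = k ∸ suc e
      e+1+q : suc e + q ≡ k
      e+1+q = m+[n∸m]≡n e<k
      rest : List ℕ
      rest = filterᵇ f (range (suc (s + e)) q)
      front : filterᵇ f (range s k) ≡ range s e ++ rest
      front = ≡.trans (≡.cong (filterᵇ f ∘ range s) (≡.trans (≡.sym e+1+q) (≡.sym (+-suc e q))))
                (≡.trans (filterᵇ-range-split f s e q fe) (≡.cong (_++ rest) (filterᵇ-range-all f s e run)))
      back : filterᵇ f (range (s + suc e) k) ≡ rest ++ filterᵇ f (range (suc (s + k)) e)
      back = ≡.trans (≡.cong (filterᵇ f ∘ range (s + suc e)) (≡.trans (≡.sym e+1+q) (+-comm (suc e) q)))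
               (≡.trans (filterᵇ-range-split f (s + suc e) q e f[s+e+1+q])
                        (≡.cong₂ (λ a b → filterᵇ f (range a q) ++ filterᵇ f (range (suc b) e)) (+-suc s e) s+e+1+q))
        where
        s+e+1+q : s + suc e + q ≡ s + k
        s+e+1+q = ≡.trans (+-assoc s (suc e) q) (≡.cong (λ j → s + j) e+1+q)
        f[s+e+1+q] : f (s + suc e + q) ≡ false
        f[s+e+1+q] = ≡.trans (≡.cong f s+e+1+q) fk
      one-period-on : ∀ i → suc (s + k) + i ≡ s + i + n
      one-period-on i = regroup s k i
        where
        regroup : ∀ s k i → suc (s + k) + i ≡ s + i + suc k
        regroup = solve-∀
      wrapped : map Tmod (filterᵇ f (range (suc (s + k)) e)) ≡ map Tmod (range s e)
      wrapped = ≡.trans (map-filterᵇ-range-cong f f Tmod Tmod (suc (s + k)) s e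
                          (λ i _ → ≡.trans (≡.cong f (one-period-on i)) (f-periodic (s + i)))
                          (λ i _ → ≡.trans (≡.cong Tmod (one-period-on i)) (Tmod-periodic (s + i))))
                        (≡.cong (map Tmod) (filterᵇ-range-all f s e run))
      run-commutes-rest : ∀ i → i < e → ∀ j → j < q → Commute (s + i) (suc (s + e) + j)
      run-commutes-rest i i<e j j<q = ≡.subst (Commute (s + i)) (≡.sym position) (commute-far (s + i) d 2≤d d<k)
        where
        t d : ℕ
        t = e ∸ suc i
        i+1+t : i + suc t ≡ e
        i+1+t = ≡.trans (+-suc i t) (m+[n∸m]≡n i<e)
        d = suc t + suc j
        regroup : ∀ s i t j → suc (s + (i + suc t)) + j ≡ (s + i) + (suc t + suc j)
        regroup = solve-∀
        position : suc (s + e) + j ≡ (s + i) + d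
        position = ≡.trans (≡.cong (λ u → suc (s + u) + j) (≡.sym i+1+t)) (regroup s i t j)
        2≤d : 2 ≤ d
        2≤d = s≤s (≡.subst (1 ≤_) (≡.sym (+-suc t j)) (s≤s z≤n))
        d<k : d < k
        d<k = ≡.subst (suc d ≤_) e+1+q (s≤s (+-mono-≤ (≡.subst (suc t ≤_) i+1+t (m≤n+m (suc t) i)) j<q))

    first-false : ∀ s m → f (s + m) ≡ false → Σ ℕ λ e → e ≤ m × f (s + e) ≡ false × (∀ i → i < e → f (s + i) ≡ true)
    first-false s m fm with f s in fs
    ... | false = 0 , z≤n , ≡.trans (≡.cong f (+-identityʳ s)) fs , λ _ ()
    first-false s zero fm | true with () ← ≡.trans (≡.sym fs) (≡.trans (≡.cong f (≡.sym (+-identityʳ s))) fm)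
    first-false s (suc m) fm | true with first-false (suc s) m (≡.trans (≡.cong f (≡.sym (+-suc s m))) fm)
    ... | e , e≤m , fe , run = suc e , s≤s e≤m , ≡.trans (≡.cong f (+-suc s e)) fe , run′
      where
      run′ : ∀ i → i < suc e → f (s + i) ≡ true
      run′ zero    _         = ≡.trans (≡.cong f (+-identityʳ s)) fs
      run′ (suc i) (s≤s i<e) = ≡.trans (≡.cong f (+-suc s i)) (run i i<e)

    window-step : ∀ s e → f (s + k) ≡ false → f (s + e) ≡ false → (∀ i → i < e → f (s + i) ≡ true) →
                  window s ≈ window (s + suc e)
    window-step s e fk fe run with <-cmp e k
    ... | tri< e<k _ _ = window-skip-run s e e<k run fe fk
    ... | tri≈ _ ≡.refl _ = sym (window-periodic s)
    ... | tri> _ _ k<e with () ← ≡.trans (≡.sym (run k k<e)) fk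

    window-cut-forward : ∀ d s → f (s + k) ≡ false → f (s + d + k) ≡ false → window s ≈ window (s + d)
    window-cut-forward = <-rec (λ d → ∀ s → f (s + k) ≡ false → f (s + d + k) ≡ false → window s ≈ window (s + d)) go
      where
      go : ∀ d → (∀ {d′} → d′ < d → ∀ s → f (s + k) ≡ false → f (s + d′ + k) ≡ false → window s ≈ window (s + d′)) →
           ∀ s → f (s + k) ≡ false → f (s + d + k) ≡ false → window s ≈ window (s + d)
      go zero    _   s _  _  = reflexive (≡.cong window (≡.sym (+-identityʳ s)))
      go (suc d) rec s fk fd with first-false s d (≡.trans (≡.sym (f-periodic (s + d))) (≡.trans (≡.cong f (wrap s d k)) fd))
        where
        wrap : ∀ s d k → s + d + suc k ≡ s + suc d + k
        wrap = solve-∀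
      ... | e , e≤d , fe , run = trans (window-step s e fk fe run) (trans (rec d-e<d (s + suc e) fk′ fd′) (reflexive (≡.cong window land)))
        where
        land : s + suc e + (d ∸ e) ≡ s + suc d
        land = ≡.trans (+-assoc s (suc e) (d ∸ e)) (≡.cong (λ j → s + suc j) (m+[n∸m]≡n e≤d))
        d-e<d : d ∸ e < suc d
        d-e<d = s≤s (m∸n≤m d e)
        fk′ : f (s + suc e + k) ≡ false
        fk′ = ≡.trans (≡.cong f (≡.trans (≡.cong (_+ k) (+-suc s e)) (≡.sym (+-suc (s + e) k)))) (≡.trans (f-periodic (s + e)) fe)
        fd′ : f (s + suc e + (d ∸ e) + k) ≡ false
        fd′ = ≡.trans (≡.cong (λ j → f (j + k)) land) fd

    window-cut : ∀ s t → f (s + k) ≡ false → f (t + k) ≡ false → window s ≈ window t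
    window-cut s t fs ft with ≤-total s t
    ... | inj₁ s≤t = trans (window-cut-forward (t ∸ s) s fs (≡.subst (λ j → f (j + k) ≡ false) (≡.sym (m+[n∸m]≡n s≤t)) ft))
                           (reflexive (≡.cong window (m+[n∸m]≡n s≤t)))
    ... | inj₂ t≤s = sym (trans (window-cut-forward (s ∸ t) t ft (≡.subst (λ j → f (j + k) ≡ false) (≡.sym (m+[n∸m]≡n t≤s)) fs))
                                (reflexive (≡.cong window (m+[n∸m]≡n t≤s))))

-- The difference (o + a) - (c + #{i < a | v (s + i)}) grows by one exactly at the a with
-- v (s + a) false; a crossing is such an a where it is still 0. So there is exactly one
-- crossing when the difference starts ≤ 0 and ends > 0, and none otherwise.
module Crossings (v : ℕ → Bool) where
  open import Data.Nat using (_+_)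
  open import Data.Nat.Properties
  open import Data.Bool.Properties using (∧-zeroʳ)
  open ≡ hiding ([_])

  truesFrom : ℕ → ℕ → ℕ
  truesFrom s m = trues (map v (range s m))

  truesFrom-++ : ∀ s p q → truesFrom s (p + q) ≡ truesFrom s p + truesFrom (s + p) q
  truesFrom-++ s p q = trans (cong (trues ∘ map v) (range-++ s p q))
                         (trans (cong trues (map-++ v (range s p) _)) (trues-++ (map v (range s p)) _))

  crossing : ℕ → ℕ → ℕ → ℕ → Bool
  crossing c o s a = not (v (s + a)) ∧ (c + truesFrom s a ≡ᵇ o + a)

  crossings : ℕ → ℕ → ℕ → ℕ → ℕ
  crossings c o s m = trues (map (crossing c o s) (range 0 m))

  truesFrom-≤ : ∀ s m → truesFrom s m ≤ m
  truesFrom-≤ s m = subst (truesFrom s m ≤_) (length-range s m) (trues-map-≤ v (range s m))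

  crossing-0 : ∀ c o s → crossing c o s 0 ≡ not (v s) ∧ (c ≡ᵇ o)
  crossing-0 c o s = cong₂ _∧_ (cong (not ∘ v) (+-identityʳ s)) (cong₂ _≡ᵇ_ (+-identityʳ c) (+-identityʳ o))

  crossings-suc : ∀ c o s m → crossings c o s (suc m) ≡ trues [ not (v s) ∧ (c ≡ᵇ o) ] + crossings (c + trues [ v s ]) (suc o) (suc s) m
  crossings-suc c o s m = begin
    trues (crossing c o s 0 ∷ map (crossing c o s) (range 1 m))
      ≡⟨ trues-∷ (crossing c o s 0) _ ⟩
    trues [ crossing c o s 0 ] + trues (map (crossing c o s) (range 1 m))
      ≡⟨ cong₂ (λ b X → trues [ b ] + trues X) (crossing-0 c o s) (map-range-cong 1 0 m (λ a _ → step a)) ⟩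
    trues [ not (v s) ∧ (c ≡ᵇ o) ] + crossings (c + trues [ v s ]) (suc o) (suc s) m ∎
    where
    open ≡-Reasoning
    step : ∀ a → crossing c o s (suc a) ≡ crossing (c + trues [ v s ]) (suc o) (suc s) a
    step a = cong₂ _∧_ (cong (not ∘ v) (+-suc s a))
               (cong₂ _≡ᵇ_ (trans (cong (c +_) (trues-∷ (v s) _)) (sym (+-assoc c _ _))) (+-suc o a))

  crossings-suc-at : ∀ c o s m {b} → v s ≡ b →
                     crossings c o s (suc m) ≡ trues [ not b ∧ (c ≡ᵇ o) ] + crossings (c + trues [ b ]) (suc o) (suc s) m
  crossings-suc-at c o s m refl = crossings-suc c o s m

  trues[b]≤1 : ∀ b → trues [ b ] ≤ 1
  trues[b]≤1 true  = ≤-refl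
  trues[b]≤1 false = z≤n

  crossings-ahead : ∀ m c o s → c < o → crossings c o s m ≡ 0
  crossings-ahead zero    c o s _   = refl
  crossings-ahead (suc m) c o s c<o = trans (crossings-suc c o s m)
    (cong₂ _+_ (cong (λ b → trues [ b ]) (trans (cong (not (v s) ∧_) (≢⇒≡ᵇ≡false (<⇒≢ c<o))) (∧-zeroʳ _)))
               (crossings-ahead m _ (suc o) (suc s) (s≤s (≤-trans (+-monoʳ-≤ c (trues[b]≤1 (v s))) (subst (_≤ o) (+-comm 1 c) c<o)))))

  crossings-never : ∀ m c o s → o + m ≤ c + truesFrom s m → crossings c o s m ≡ 0
  crossings-never zero    c o s _ = refl
  crossings-never (suc m) c o s h = trans (crossings-suc c o s m) (cong₂ _+_ (cong (λ b → trues [ b ]) no-crossing-here)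
    (crossings-never m _ (suc o) (suc s) (subst₂ _≤_ (+-suc o m) (trans (cong (c +_) (trues-∷ (v s) _)) (sym (+-assoc c _ _))) h)))
    where
    no-crossing-here : not (v s) ∧ (c ≡ᵇ o) ≡ false
    no-crossing-here with v s | c ≟ o
    ... | true  | _      = refl
    ... | false | no c≢o = ≢⇒≡ᵇ≡false c≢o
    ... | false | yes refl = ⊥-elim (<⇒≱ (s≤s (truesFrom-≤ (suc s) m)) (+-cancelˡ-≤ c _ _ h))

  crossings-once : ∀ m c o s → o ≤ c → c + truesFrom s m < o + m → crossings c o s m ≡ 1
  crossings-once zero    c o s o≤c h = ⊥-elim (<⇒≱ h (+-monoˡ-≤ 0 o≤c))
  crossings-once (suc m) c o s o≤c h with v s in vs
  ... | true = begin
    crossings c o s (suc m)                                   ≡⟨ crossings-suc-at c o s m vs ⟩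
    0 + crossings (c + 1) (suc o) (suc s) m                   ≡⟨ crossings-once m (c + 1) (suc o) (suc s) o+1≤c+1 h′ ⟩
    1                                                         ∎
    where
    open ≡-Reasoning
    o+1≤c+1 : suc o ≤ c + 1
    o+1≤c+1 = subst (_≤ c + 1) (+-comm o 1) (+-monoˡ-≤ 1 o≤c)
    h′ : c + 1 + truesFrom (suc s) m < suc o + m
    h′ = subst₂ _<_ (sym (+-assoc c 1 _)) (+-suc o m) h
  ... | false with c ≟ o
  ...   | yes refl = begin
    crossings c c s (suc m)                                   ≡⟨ crossings-suc-at c c s m vs ⟩
    trues [ c ≡ᵇ c ] + crossings (c + 0) (suc c) (suc s) m    ≡⟨ cong₂ (λ b n → trues [ b ] + n) (≡ᵇ-refl c)
                                                                   (crossings-ahead m (c + 0) (suc c) (suc s) (s≤s (≤-reflexive (+-identityʳ c)))) ⟩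
    1                                                         ∎
    where open ≡-Reasoning
  ...   | no c≢o = begin
    crossings c o s (suc m)                                   ≡⟨ crossings-suc-at c o s m vs ⟩
    trues [ c ≡ᵇ o ] + crossings (c + 0) (suc o) (suc s) m    ≡⟨ cong (λ b → trues [ b ] + crossings (c + 0) (suc o) (suc s) m)
                                                                   (≢⇒≡ᵇ≡false c≢o) ⟩
    crossings (c + 0) (suc o) (suc s) m                       ≡⟨ crossings-once m (c + 0) (suc o) (suc s) o<c h′ ⟩
    1                                                         ∎
    where
    open ≡-Reasoning
    o<c : suc o ≤ c + 0
    o<c = subst (suc o ≤_) (sym (+-identityʳ c)) (≤∧≢⇒< o≤c (c≢o ∘ sym))
    h′ : c + 0 + truesFrom (suc s) m < suc o + m
    h′ = subst₂ _<_ (sym (+-assoc c 0 _)) (+-suc o m) h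

module Rotations (k : ℕ) {c ℓ : Level} (R : Ring c ℓ) where
  open Ring R using (Carrier; _≈_; 0#; _+_; setoid; refl; sym; trans; reflexive; +-cong; +-identityʳ)
  open Sums R
  open import Data.Nat.DivMod using (_%_; [m+n]%n≡m%n; m<n⇒m%n≡m)
  open import Relation.Binary.Reasoning.Setoid setoid

  rotate : List Bool → List Bool
  rotate []       = []
  rotate (x ∷ xs) = xs ++ [ x ]

  trues-rotate : ∀ X → trues (rotate X) ≡ trues X
  trues-rotate []       = ≡.refl
  trues-rotate (x ∷ xs) = trues-∷ʳ x xs

  ∑masks-rotate : ∀ (F : List Bool → Carrier) → ∑masks (suc k) (F ∘ rotate) ≈ ∑masks (suc k) F
  ∑masks-rotate F = sym (∑masks-∷ʳ k F)

  cyclic : List Bool → ℕ → Bool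
  cyclic L x = bitAt L (x % suc k)

  cyclic-periodic : ∀ L x → cyclic L (x ℕ.+ suc k) ≡ cyclic L x
  cyclic-periodic L x = ≡.cong (bitAt L) ([m+n]%n≡m%n x (suc k))

  cyclic-range-0 : ∀ L → length L ≡ suc k → map (cyclic L) (range 0 (suc k)) ≡ L
  cyclic-range-0 L len = ≡.trans (map-range-cong 0 0 (suc k) (λ i i<n → ≡.cong (bitAt L) (m<n⇒m%n≡m i<n)))
                           (≡.trans (≡.cong (λ m → map (bitAt L) (range 0 m)) (≡.sym len)) (map-bitAt-range L))

  cyclic-range-suc : ∀ L s → map (cyclic L) (range (suc s) (suc k)) ≡ rotate (map (cyclic L) (range s (suc k)))
  cyclic-range-suc L s =
    ≡.trans (≡.cong (map (cyclic L)) (≡.trans (≡.cong (range (suc s)) (ℕₚ.+-comm 1 k)) (range-++ (suc s) k 1)))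
      (≡.trans (map-++ (cyclic L) (range (suc s) k) [ suc s ℕ.+ k ])
        (≡.cong (λ b → map (cyclic L) (range (suc s) k) ++ [ b ]) (≡.trans (≡.cong (cyclic L) (≡.sym (ℕₚ.+-suc s k))) (cyclic-periodic L s))))

  trues-cyclic : ∀ L → length L ≡ suc k → ∀ s → trues (map (cyclic L) (range s (suc k))) ≡ trues L
  trues-cyclic L len zero    = ≡.cong trues (cyclic-range-0 L len)
  trues-cyclic L len (suc s) = ≡.trans (≡.cong trues (cyclic-range-suc L s))
                                 (≡.trans (trues-rotate (map (cyclic L) (range s (suc k)))) (trues-cyclic L len s))

  ∑masks-cyclic : ∀ s (F : List Bool → Carrier) → ∑masks (suc k) (λ L → F (map (cyclic L) (range s (suc k)))) ≈ ∑masks (suc k) F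
  ∑masks-cyclic zero    F = ∑masks-cong (suc k) (λ L len → reflexive (≡.cong F (cyclic-range-0 L len)))
  ∑masks-cyclic (suc s) F = begin
    ∑masks (suc k) (λ L → F (map (cyclic L) (range (suc s) (suc k))))
      ≈⟨ ∑masks-cong (suc k) (λ L _ → reflexive (≡.cong F (cyclic-range-suc L s))) ⟩
    ∑masks (suc k) (λ L → F (rotate (map (cyclic L) (range s (suc k))))) ≈⟨ ∑masks-cyclic s (F ∘ rotate) ⟩
    ∑masks (suc k) (F ∘ rotate)                                          ≈⟨ ∑masks-rotate F ⟩
    ∑masks (suc k) F                                                     ∎

  -- Masks of length k are the subsets of I avoiding the residue of s + k, read cyclically from s.
  ∑masks-cyclic-window : ∀ s (H : List Bool → Carrier) →
    ∑masks k H ≈ ∑masks (suc k) (λ L → if cyclic L (s ℕ.+ k) then 0# else H (map (cyclic L) (range s k)))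
  ∑masks-cyclic-window s H = begin
    ∑masks k H
      ≈⟨ ∑masks-cong k (λ Z len → sym (trans (+-cong (reflexive (padded-false Z len)) (reflexive (padded-true Z len))) (+-identityʳ _))) ⟩
    ∑masks k (λ Z → H′ (Z ++ [ false ]) + H′ (Z ++ [ true ])) ≈⟨ ∑masks-+ k _ _ ⟩
    ∑masks k (λ Z → H′ (Z ++ [ false ])) + ∑masks k (λ Z → H′ (Z ++ [ true ])) ≈⟨ sym (∑masks-∷ʳ k H′) ⟩
    ∑masks (suc k) H′                                         ≈⟨ sym (∑masks-cyclic s H′) ⟩
    ∑masks (suc k) (λ L → H′ (map (cyclic L) (range s (suc k))))
      ≈⟨ ∑masks-cong (suc k) (λ L _ → reflexive (≡.cong₂ (λ b Z → if b then 0# else H Z)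
                                          (bitAt-map-range (cyclic L) s (suc k) k ℕₚ.≤-refl)
                                          (take-map-range (cyclic L) s (suc k) k (ℕₚ.n≤1+n k)))) ⟩
    ∑masks (suc k) (λ L → if cyclic L (s ℕ.+ k) then 0# else H (map (cyclic L) (range s k))) ∎
    where
    H′ : List Bool → Carrier
    H′ W = if bitAt W k then 0# else H (take k W)
    last-bit : ∀ Z b → length Z ≡ k → bitAt (Z ++ [ b ]) k ≡ b
    last-bit Z b len = ≡.subst (λ i → bitAt (Z ++ [ b ]) i ≡ b) len (bitAt-length-++ Z b [])
    init : ∀ Z b → length Z ≡ k → take k (Z ++ [ b ]) ≡ Z
    init Z b len = ≡.subst (λ i → take i (Z ++ [ b ]) ≡ Z) len (take-length-++ Z [ b ])
    padded-false : ∀ Z → length Z ≡ k → H′ (Z ++ [ false ]) ≡ H Z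
    padded-false Z len = ≡.cong₂ (λ b Z′ → if b then 0# else H Z′) (last-bit Z false len) (init Z false len)
    padded-true : ∀ Z → length Z ≡ k → H′ (Z ++ [ true ]) ≡ 0#
    padded-true Z len = ≡.cong (λ b → if b then 0# else H (take k (Z ++ [ true ]))) (last-bit Z true len)

module Summand (k r : ℕ) (r≤k : r ≤ k) (l : ℤ) {c ℓ : Level} (R : Ring c ℓ) (T : Fin (suc k) → Ring.Carrier R) where
  open Ring R using (Carrier; _≈_; _+_; _*_; 0#; 1#; setoid; refl; sym; trans; reflexive; *-cong)
  open Sums R
  open Residues k
  open Words k R T using (Tmod; word; word-++; word-range-≡)
  open Rotations k R using (cyclic; ∑masks-cyclic-window)
  open import Data.Integer using (+_)
  open import Data.Integer.DivMod using (_%ℕ_; n%ℕd<d)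
  open import Data.Integer.Tactic.RingSolver using (solve-∀)
  open import Data.Nat.DivMod using (_mod_; _%_; m<n⇒m%n≡m)
  open import Data.List.Properties using (length-map; length-upTo)
  open import Relation.Binary.Reasoning.Setoid setoid

  interval-of-length : ∀ lo hi m → hi ℤ.- lo ℤ.+ + 1 ≡ + m → interval lo hi ≡ map (λ i → lo ℤ.+ + i) (upTo m)
  interval-of-length lo hi m len =
    ≡.cong (λ j → map (λ i → lo ℤ.+ + i) (upTo j)) (≡.trans (≡.cong (λ j → ℤ.∣ j ℤ.⊔ + 0 ∣) len) (ℕₚ.⊔-identityʳ m))

  D : Fin (suc k) → Carrier
  D i = T i + 1#

  summand : ℕ → Carrier
  summand a = ∑ (map (λ ps → ∏ (map (λ p → D (𝔯 k p)) (reverse (interval (l ℤ.+ + 1) (l ℤ.+ (+ r ℤ.- + a)))))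
                           * ∏ (map (λ p → T (𝔯 k p)) (reverse ps)))
                   (choose a (interval (l ℤ.- + k ℤ.+ + 1 ℤ.+ + r ℤ.- + a) l)))

  LHS≡sum-summand : LHS R k r l T ≡ ∑ (map summand (upTo (suc r)))
  LHS≡sum-summand = ≡.refl

  -- toℕ (𝔯 k l), written in the shape in which 𝔯-reverse-run produces it
  𝔯l : ℕ
  𝔯l = (+ 2 ℤ.- (l ℤ.+ + 1)) %ℕ n

  -- first residue of the run of D-factors of the a-th summand
  origin : ℕ → ℕ
  origin a = (+ 2 ℤ.- ((l ℤ.+ + 1) ℤ.+ + (r ∸ a))) %ℕ n

  -- Z selects letters from the window origin a, …, origin a + k - 1; its last k - (r - a) bits
  -- select among the T-factors and must contain exactly a ones.
  summandMask : ℕ → List Bool → Carrier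
  summandMask a Z = if trues (drop (r ∸ a) Z) ≡ᵇ a then word Z (range (origin a) k) else 0#

  summandSubset : ℕ → List Bool → Carrier
  summandSubset a L = if cyclic L (origin a ℕ.+ k) then 0# else summandMask a (map (cyclic L) (range (origin a) k))

  module _ (a : ℕ) (a≤r : a ≤ r) where
    b m : ℕ
    b = r ∸ a
    m = k ∸ b
    b≤k : b ≤ k
    b≤k = ℕₚ.≤-trans (ℕₚ.m∸n≤m r a) r≤k
    b+m : b ℕ.+ m ≡ k
    b+m = ℕₚ.m+[n∸m]≡n b≤k

    +r-a : + r ℤ.- + a ≡ + b
    +r-a = ≡.sym (pos-∸ r a a≤r)
    +m : + m ≡ + k ℤ.- (+ r ℤ.- + a)
    +m = ≡.trans (pos-∸ k b b≤k) (≡.cong (λ j → + k ℤ.- j) (≡.sym +r-a))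

    loD loT : ℤ
    loD = l ℤ.+ + 1
    loT = l ℤ.- + k ℤ.+ + 1 ℤ.+ + r ℤ.- + a

    D-interval : interval loD (l ℤ.+ (+ r ℤ.- + a)) ≡ map (λ i → loD ℤ.+ + i) (upTo b)
    D-interval = interval-of-length loD (l ℤ.+ (+ r ℤ.- + a)) b (≡.trans (length-D l (+ r ℤ.- + a)) +r-a)
      where
      length-D : ∀ (l x : ℤ) → (l ℤ.+ x) ℤ.- (l ℤ.+ + 1) ℤ.+ + 1 ≡ x
      length-D = solve-∀

    T-interval : interval loT l ≡ map (λ i → loT ℤ.+ + i) (upTo m)
    T-interval = interval-of-length loT l m (≡.trans (length-T l (+ k) (+ r) (+ a)) (≡.sym +m))
      where
      length-T : ∀ (l k r a : ℤ) → l ℤ.- (l ℤ.- k ℤ.+ + 1 ℤ.+ r ℤ.- a) ℤ.+ + 1 ≡ k ℤ.- (r ℤ.- a)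
      length-T = solve-∀

    -- The T-run starts at 𝔯 l, right after the D-run: together they cover origin a, …, origin a + k - 1.
    T-start : (+ 2 ℤ.- (loT ℤ.+ + m)) %ℕ n ≡ 𝔯l
    T-start = ≡.cong (_%ℕ n) (≡.trans (≡.cong (λ j → + 2 ℤ.- (loT ℤ.+ j)) +m) (regroup l (+ k) (+ r) (+ a)))
      where
      regroup : ∀ (l k r a : ℤ) → + 2 ℤ.- ((l ℤ.- k ℤ.+ + 1 ℤ.+ r ℤ.- a) ℤ.+ (k ℤ.- (r ℤ.- a))) ≡ + 2 ℤ.- (l ℤ.+ + 1)
      regroup = solve-∀

    D-end : (origin a ℕ.+ b) % n ≡ 𝔯l % n
    D-end = ≡.trans (≡.sym (%ℕ-+ (+ 2 ℤ.- (loD ℤ.+ + b)) b))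
              (≡.trans (≡.cong (_%ℕ n) (regroup l (+ b))) (≡.sym (m<n⇒m%n≡m (n%ℕd<d (+ 2 ℤ.- (l ℤ.+ + 1)) n))))
      where
      regroup : ∀ (l b : ℤ) → (+ 2 ℤ.- ((l ℤ.+ + 1) ℤ.+ b)) ℤ.+ b ≡ + 2 ℤ.- (l ℤ.+ + 1)
      regroup = solve-∀

    Dproduct : Carrier
    Dproduct = ∏ (map (λ p → D (𝔯 k p)) (reverse (interval loD (l ℤ.+ (+ r ℤ.- + a)))))

    Tproduct : List ℤ → Carrier
    Tproduct ps = ∏ (map (λ p → T (𝔯 k p)) (reverse ps))

    Tmask : List Bool → Carrier
    Tmask Y = if trues Y ≡ᵇ a then word Y (range 𝔯l m) else 0#

    D-run : Dproduct ≈ ∑masks b (λ Y → word Y (range (origin a) b))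
    D-run = begin
      Dproduct                                         ≡⟨ ≡.cong (λ is → ∏ (map (λ p → D (𝔯 k p)) (reverse is))) D-interval ⟩
      ∏ (map (λ p → D (𝔯 k p)) (reverse ID))          ≡⟨ ≡.cong ∏ (map-∘ (reverse ID)) ⟩
      ∏ (map D (map (𝔯 k) (reverse ID)))               ≡⟨ ≡.cong (∏ ∘ map D) (𝔯-reverse-run loD b) ⟩
      ∏ (map D (map (_mod n) (range (origin a) b)))    ≡⟨ ≡.cong ∏ (≡.sym (map-∘ (range (origin a) b))) ⟩
      ∏ (map (λ x → Tmod x + 1#) (range (origin a) b)) ≈⟨ prod-map-+1 Tmod (range (origin a) b) ⟩
      ∑masks (length (range (origin a) b)) (λ Y → word Y (range (origin a) b)) ≈⟨ ∑masks-≡ (length-range (origin a) b) _ ⟩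
      ∑masks b (λ Y → word Y (range (origin a) b))     ∎
      where
      ID : List ℤ
      ID = map (λ i → loD ℤ.+ + i) (upTo b)

    T-subsets : ∑ (map Tproduct (choose a (interval loT l))) ≈ ∑masks m Tmask
    T-subsets = begin
      ∑ (map Tproduct (choose a (interval loT l)))  ≡⟨ ≡.cong (λ is → ∑ (map Tproduct (choose a is))) T-interval ⟩
      ∑ (map Tproduct (choose a IT))                ≈⟨ sum-map-choose a Tproduct IT ⟩
      ∑masks (length IT) (λ X → if trues X ≡ᵇ a then Tproduct (select X IT) else 0#) ≈⟨ ∑masks-≡ length-IT _ ⟩
      ∑masks m (λ X → if trues X ≡ᵇ a then Tproduct (select X IT) else 0#)
        ≈⟨ ∑masks-cong m (λ X len → trans (reflexive (≡.cong (λ t → if t ≡ᵇ a then Tproduct (select X IT) else 0#) (≡.sym (trues-reverse X))))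
                                          (if-cong (trues (reverse X) ≡ᵇ a) (Tproduct-select X len))) ⟩
      ∑masks m (Tmask ∘ reverse)                    ≈⟨ ∑masks-reverse m Tmask ⟩
      ∑masks m Tmask                                ∎
      where
      IT : List ℤ
      IT = map (λ i → loT ℤ.+ + i) (upTo m)
      length-IT : length IT ≡ m
      length-IT = ≡.trans (length-map _ (upTo m)) (length-upTo m)
      Tproduct-select : ∀ X → length X ≡ m → Tproduct (select X IT) ≈ word (reverse X) (range 𝔯l m)
      Tproduct-select X len = begin
        ∏ (map (λ p → T (𝔯 k p)) (reverse (select X IT)))           ≡⟨ ≡.cong (∏ ∘ map (λ p → T (𝔯 k p)))
                                                                         (reverse-select X IT (≡.trans len (≡.sym length-IT))) ⟩
        ∏ (map (λ p → T (𝔯 k p)) (select (reverse X) (reverse IT))) ≡⟨ ≡.cong ∏ (map-∘ (select (reverse X) (reverse IT))) ⟩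
        ∏ (map T (map (𝔯 k) (select (reverse X) (reverse IT))))     ≡⟨ ≡.cong (∏ ∘ map T) (≡.sym (select-map (𝔯 k) (reverse X) (reverse IT))) ⟩
        ∏ (map T (select (reverse X) (map (𝔯 k) (reverse IT))))     ≡⟨ ≡.cong (∏ ∘ map T ∘ select (reverse X)) (𝔯-reverse-run loT m) ⟩
        ∏ (map T (select (reverse X) (map (_mod n) (range _ m))))   ≡⟨ ≡.cong (∏ ∘ map T) (select-map (_mod n) (reverse X) (range _ m)) ⟩
        ∏ (map T (map (_mod n) (select (reverse X) (range _ m))))   ≡⟨ ≡.cong ∏ (≡.sym (map-∘ (select (reverse X) (range _ m)))) ⟩
        word (reverse X) (range _ m)                                ≡⟨ ≡.cong (λ s → word (reverse X) (range s m)) T-start ⟩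
        word (reverse X) (range 𝔯l m)                               ∎

    summand≈ : summand a ≈ ∑masks (suc k) (summandSubset a)
    summand≈ = begin
      summand a                                                ≈⟨ sym (*-sum-map Dproduct Tproduct (choose a (interval loT l))) ⟩
      Dproduct * ∑ (map Tproduct (choose a (interval loT l)))  ≈⟨ *-cong D-run T-subsets ⟩
      ∑masks b (λ Y → word Y Drun) * ∑masks m Tmask            ≈⟨ ∑masks-* b _ _ ⟩
      ∑masks b (λ Y → word Y Drun * ∑masks m Tmask)            ≈⟨ ∑masks-cong b (λ Y len → trans (*-∑masks m _ Tmask)
                                                                                                  (∑masks-cong m (λ X _ → split Y X len))) ⟩
      ∑masks b (λ Y → ∑masks m (λ X → summandMask a (Y ++ X))) ≈⟨ sym (∑masks-++ b m (summandMask a)) ⟩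
      ∑masks (b ℕ.+ m) (summandMask a)                         ≈⟨ ∑masks-≡ b+m (summandMask a) ⟩
      ∑masks k (summandMask a)                                 ≈⟨ ∑masks-cyclic-window (origin a) (summandMask a) ⟩
      ∑masks (suc k) (summandSubset a)                         ∎
      where
      Drun : List ℕ
      Drun = range (origin a) b
      runs : ∀ Y X → length Y ≡ b → word (Y ++ X) (range (origin a) k) ≈ word Y Drun * word X (range 𝔯l m)
      runs Y X len = begin
        word (Y ++ X) (range (origin a) k)                       ≡⟨ ≡.cong (word (Y ++ X))
                                                                      (≡.trans (≡.cong (range (origin a)) (≡.sym b+m)) (range-++ (origin a) b m)) ⟩
        word (Y ++ X) (Drun ++ range (origin a ℕ.+ b) m)          ≈⟨ word-++ Y X Drun _ (≡.trans len (≡.sym (length-range (origin a) b))) ⟩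
        word Y Drun * word X (range (origin a ℕ.+ b) m)           ≡⟨ ≡.cong (word Y Drun *_) (word-range-≡ X (origin a ℕ.+ b) 𝔯l m D-end) ⟩
        word Y Drun * word X (range 𝔯l m)                         ∎
      split : ∀ Y X → length Y ≡ b → word Y Drun * Tmask X ≈ summandMask a (Y ++ X)
      split Y X len = begin
        word Y Drun * Tmask X                                                    ≈⟨ *-if (trues X ≡ᵇ a) _ _ ⟩
        (if trues X ≡ᵇ a then word Y Drun * word X (range 𝔯l m) else 0#)     ≈⟨ if-cong (trues X ≡ᵇ a) (sym (runs Y X len)) ⟩
        (if trues X ≡ᵇ a then word (Y ++ X) (range (origin a) k) else 0#)    ≡⟨ ≡.cong (λ Z → if trues Z ≡ᵇ a then word (Y ++ X) (range (origin a) k) else 0#)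
                                                                                   (≡.sym (≡.subst (λ i → drop i (Y ++ X) ≡ X) len (drop-length-++ Y X))) ⟩
        summandMask a (Y ++ X)                                               ∎

module FirstOutside {k : ℕ} (A : Subset (suc k)) where
  open ≡ hiding ([_])

  firstOutsideIn : List (Fin (suc k)) → Fin (suc k)
  firstOutsideIn []       = Fin.zero
  firstOutsideIn (i ∷ is) = if lookup A i then firstOutsideIn is else i

  -- Defs computes firstOutside with a local helper that cannot be referred to by name;
  -- any function obeying the same two equations agrees with firstOutsideIn.
  satisfies-firstOutsideIn-equations : {h : List (Fin (suc k)) → Fin (suc k)} → h [] ≡ Fin.zero →
    (∀ i is → h (i ∷ is) ≡ (if lookup A i then h is else i)) → ∀ xs → h xs ≡ firstOutsideIn xs
  satisfies-firstOutsideIn-equations h[] h∷ []       = h[]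
  satisfies-firstOutsideIn-equations {h} h[] h∷ (i ∷ is) with lookup A i in Ai
  ... | true  = trans (h∷ i is) (trans (cong (λ b → if b then h is else i) Ai) (satisfies-firstOutsideIn-equations h[] h∷ is))
  ... | false = trans (h∷ i is) (cong (λ b → if b then h is else i) Ai)

  firstOutside≡ : firstOutside A ≡ firstOutsideIn (allFin (suc k))
  firstOutside≡ with Data.List.tabulate {n = k} Fin.suc | satisfies-firstOutsideIn-equations {h = _}
  ... | is | agrees = cong (λ j → if lookup A Fin.zero then j else Fin.zero) (agrees refl (λ _ _ → refl) is)

  firstOutsideIn-outside : ∀ xs → lookup A (firstOutsideIn xs) ≡ false ⊎ All (λ i → lookup A i ≡ true) xs
  firstOutsideIn-outside []       = inj₂ []
  firstOutsideIn-outside (i ∷ is) with lookup A i in Ai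
  ... | false = inj₁ Ai
  ... | true with firstOutsideIn-outside is
  ...   | inj₁ out = inj₁ out
  ...   | inj₂ all = inj₂ (Ai ∷ all)

  firstOutside-outside : ∀ j → lookup A j ≡ false → lookup A (firstOutside A) ≡ false
  firstOutside-outside j Aj with firstOutsideIn-outside (allFin (suc k))
  ... | inj₁ out = trans (cong (lookup A) firstOutside≡) out
  ... | inj₂ all with () ← trans (sym (All.lookup all (∈-allFin j))) Aj

module SubsetContributions (k r : ℕ) (r≤k : r ≤ k) (l : ℤ) {c ℓ : Level} (R : Ring c ℓ) (T : Fin (suc k) → Ring.Carrier R)
                   (H : IsZeroHecke R k T) where
  open Ring R using (Carrier; _≈_; 0#; setoid; refl; sym; trans; reflexive; +-identityʳ)
  open Sums R
  open Residues k using (n; toℕ-mod; %-+; %-cong-+)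
  open Words k R T using (Tmod; word; module Windows)
  open Rotations k R using (cyclic; cyclic-periodic; cyclic-range-0; trues-cyclic)
  open Summand k r r≤k l R T hiding (b; m)
  open import Data.Nat using (_+_)
  open import Data.Nat.DivMod using (_mod_; _%_; m<n⇒m%n≡m)
  open import Data.Fin.Properties using (toℕ<n)
  open import Data.List.Properties using (filter-accept; filter-reject)
  open import Relation.Nullary.Decidable using (dec-true; dec-false)
  open import Relation.Binary.Reasoning.Setoid setoid

  module _ (L : List Bool) (len : length L ≡ suc k) where
    V : Subset (suc k)
    V = toSubset (suc k) L

    f : ℕ → Bool
    f = cyclic L

    open Windows (IsZeroHecke.commute H) f (cyclic-periodic L) using (window; window-cut)
    open FirstOutside V using (firstOutside-outside)

    lookup-V : ∀ x → lookup V (x mod n) ≡ f x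
    lookup-V x = ≡.trans (lookup-toSubset (suc k) L (x mod n)) (≡.cong (bitAt L) (toℕ-mod x))

    ∈V? : Relation.Unary.Decidable (λ i → lookup V i ≡ true)
    ∈V? i = lookup V i Data.Bool.≟ true

    filter-V-mod : ∀ xs → filter ∈V? (map (_mod n) xs) ≡ map (_mod n) (filterᵇ f xs)
    filter-V-mod []       = ≡.refl
    filter-V-mod (x ∷ xs) with f x in fx
    ... | true  = ≡.trans (filter-accept ∈V? (≡.trans (lookup-V x) fx)) (≡.cong ((x mod n) ∷_) (filter-V-mod xs))
    ... | false = ≡.trans (filter-reject ∈V? (λ Vx → false≢true (≡.trans (≡.sym (≡.trans (lookup-V x) fx)) Vx))) (filter-V-mod xs)
      where
      false≢true : false ≢ true
      false≢true ()

    fo : ℕ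
    fo = toℕ (firstOutside V)

    Tu≡window : Tu R k T V ≡ window (suc fo)
    Tu≡window = ≡.cong ∏ (≡.trans (≡.cong (map T) (≡.trans (≡.cong (filter ∈V?) word-indices)
                                                            (filter-V-mod (range (suc fo) k))))
                                  (≡.sym (map-∘ (filterᵇ f (range (suc fo) k)))))
      where
      word-indices : map (λ m → (fo + suc m) mod n) (upTo k) ≡ map (_mod n) (range (suc fo) k)
      word-indices = ≡.trans (≡.cong (map (λ m → (fo + suc m) mod n)) (upTo≡range k))
                       (map-range-cong 0 (suc fo) k (λ i _ → ≡.cong (_mod n) (ℕₚ.+-suc fo i)))

    fo-cut : ∀ j → lookup V j ≡ false → f (suc fo + k) ≡ false
    fo-cut j Vj = ≡.trans (≡.cong f (≡.sym (ℕₚ.+-suc fo k))) (≡.trans (cyclic-periodic L fo)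
                    (≡.trans (≡.cong (bitAt L) (m<n⇒m%n≡m (toℕ<n (firstOutside V))))
                      (≡.trans (≡.sym (lookup-toSubset (suc k) L (firstOutside V))) (firstOutside-outside j Vj))))

    crosses : ℕ → Bool
    crosses a = not (f (origin a + k)) ∧ (trues (drop (r ∸ a) (map f (range (origin a) k))) ≡ᵇ a)

    summandSubset-at : ∀ a → summandSubset a L ≈ (if crosses a then Tu R k T V else 0#)
    summandSubset-at a with f (origin a + k) in cut
    ... | true  = refl
    ... | false with trues (drop (r ∸ a) (map f (range (origin a) k))) ≡ᵇ a
    ...   | false = refl
    ...   | true  = begin
      word (map f (range (origin a) k)) (range (origin a) k) ≡⟨ ≡.cong (∏ ∘ map Tmod) (select-self f (range (origin a) k)) ⟩
      window (origin a)                                      ≈⟨ window-cut (origin a) (suc fo) cut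
                                                                  (fo-cut ((origin a + k) mod n) (≡.trans (lookup-V (origin a + k)) cut)) ⟩
      window (suc fo)                                        ≡⟨ ≡.sym Tu≡window ⟩
      Tu R k T V                                             ∎

    m₀ : ℕ
    m₀ = k ∸ r

    open Crossings (λ i → f (𝔯l + i))

    c₀ : ℕ
    c₀ = truesFrom 0 m₀

    crosses≡crossing : ∀ a → a ≤ r → crosses a ≡ crossing c₀ 0 m₀ a
    crosses≡crossing a a≤r = ≡.cong₂ (λ x y → not x ∧ (y ≡ᵇ a)) at-cut count
      where
      b m : ℕ
      b = r ∸ a
      m = k ∸ b
      m≡m₀+a : m ≡ m₀ + a
      m≡m₀+a = ≡.trans (≡.cong (_∸ b) (≡.sym (ℕₚ.m∸n+n≡m r≤k)))
                 (≡.trans (ℕₚ.+-∸-assoc m₀ (ℕₚ.m∸n≤m r a)) (≡.cong (m₀ +_) (ℕₚ.m∸[m∸n]≡n a≤r)))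
      shift : ∀ i → (origin a + b + i) % n ≡ (𝔯l + i) % n
      shift i = %-cong-+ (origin a + b) 𝔯l i (D-end a a≤r)
      origin+k : origin a + k ≡ origin a + b + m
      origin+k = ≡.trans (≡.cong (origin a +_) (≡.sym (b+m a a≤r))) (≡.sym (ℕₚ.+-assoc (origin a) b m))
      at-cut : f (origin a + k) ≡ f (𝔯l + (m₀ + a))
      at-cut = ≡.cong (bitAt L) (≡.trans (≡.cong (_% n) origin+k) (≡.trans (shift m) (≡.cong (λ j → (𝔯l + j) % n) m≡m₀+a)))
      count : trues (drop b (map f (range (origin a) k))) ≡ c₀ + truesFrom m₀ a
      count = ≡.trans (≡.cong trues (drop-map-range f (origin a) k b (b≤k a a≤r)))
                (≡.trans (≡.cong trues (map-range-cong (origin a + b) 0 m (λ i _ → ≡.cong (bitAt L) (shift i))))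
                  (≡.trans (≡.cong (truesFrom 0) m≡m₀+a) (truesFrom-++ 0 m₀ a)))

    total : c₀ + truesFrom m₀ (suc r) ≡ trues L
    total = ≡.trans (≡.sym (truesFrom-++ 0 m₀ (suc r)))
              (≡.trans (≡.cong (truesFrom 0) (≡.trans (ℕₚ.+-suc m₀ r) (≡.cong suc (ℕₚ.m∸n+n≡m r≤k))))
                (≡.trans (≡.cong trues (map-range-cong {g = f} 0 𝔯l (suc k) (λ _ _ → ≡.refl))) (trues-cyclic L len 𝔯l)))

    ∣V∣ : ∣ V ∣ ≡ trues L
    ∣V∣ = ∣toSubset∣ (suc k) L len

    crossings-×-Tu : crossings c₀ 0 m₀ (suc r) ×ₙ Tu R k T V ≈ (if does (∣ V ∣ ≤? r) then Tu R k T V else 0#)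
    crossings-×-Tu with trues L ℕ.≤? r
    ... | yes ∣L∣≤r = begin
      crossings c₀ 0 m₀ (suc r) ×ₙ Tu R k T V        ≡⟨ ≡.cong (_×ₙ Tu R k T V) once ⟩
      1 ×ₙ Tu R k T V                                 ≈⟨ +-identityʳ _ ⟩
      Tu R k T V                                      ≡⟨ ≡.cong (λ b → if b then Tu R k T V else 0#) (≡.sym ∣V∣≤?r) ⟩
      (if does (∣ V ∣ ≤? r) then Tu R k T V else 0#) ∎
      where
      once : crossings c₀ 0 m₀ (suc r) ≡ 1
      once = crossings-once (suc r) c₀ 0 m₀ z≤n (≡.subst (_< suc r) (≡.sym total) (s≤s ∣L∣≤r))
      ∣V∣≤?r : does (∣ V ∣ ≤? r) ≡ true
      ∣V∣≤?r = dec-true (∣ V ∣ ≤? r) (≡.subst (_≤ r) (≡.sym ∣V∣) ∣L∣≤r)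
    ... | no ∣L∣≰r = reflexive (≡.trans (≡.cong (_×ₙ Tu R k T V) never) (≡.cong (λ b → if b then Tu R k T V else 0#) (≡.sym ∣V∣≤?r)))
      where
      never : crossings c₀ 0 m₀ (suc r) ≡ 0
      never = crossings-never (suc r) c₀ 0 m₀ (≡.subst (suc r ≤_) (≡.sym total) (ℕₚ.≰⇒> ∣L∣≰r))
      ∣V∣≤?r : does (∣ V ∣ ≤? r) ≡ false
      ∣V∣≤?r = dec-false (∣ V ∣ ≤? r) (∣L∣≰r ∘ ≡.subst (_≤ r) ∣V∣)

    sum-summandSubset : ∑ (map (λ a → summandSubset a L) (range 0 (suc r))) ≈ (if does (∣ V ∣ ≤? r) then Tu R k T V else 0#)
    sum-summandSubset = begin
      ∑ (map (λ a → summandSubset a L) (range 0 (suc r)))                  ≈⟨ sum-map-range-cong _ _ 0 (suc r) (λ a _ → summandSubset-at a) ⟩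
      ∑ (map (λ a → if crosses a then Tu R k T V else 0#) (range 0 (suc r))) ≡⟨ ≡.cong ∑ (map-∘ (range 0 (suc r))) ⟩
      ∑ (map (λ b → if b then Tu R k T V else 0#) (map crosses (range 0 (suc r)))) ≈⟨ sum-if-trues (map crosses (range 0 (suc r))) _ ⟩
      trues (map crosses (range 0 (suc r))) ×ₙ Tu R k T V                  ≡⟨ ≡.cong (λ t → trues t ×ₙ Tu R k T V)
                                                                                 (map-range-cong 0 0 (suc r) (λ a a≤r → crosses≡crossing a (ℕₚ.≤-pred a≤r))) ⟩
      crossings c₀ 0 m₀ (suc r) ×ₙ Tu R k T V                              ≈⟨ crossings-×-Tu ⟩
      (if does (∣ V ∣ ≤? r) then Tu R k T V else 0#)                        ∎

proposition3p41 : ∀ {c ℓ'} (k : ℕ) → 1 ≤ k → (r : ℕ) → 1 ≤ r → r ≤ k → (l : ℤ)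
    → (R : Ring c ℓ') → (T : Fin (suc k) → Ring.Carrier R) → IsZeroHecke R k T
    → Ring._≈_ R (LHS R k r l T) (RHS R k r T)
proposition3p41 k _ r _ r≤k l R T H = begin
  LHS R k r l T
    ≡⟨ ≡.trans LHS≡sum-summand (≡.cong (∑ ∘ map summand) (upTo≡range (suc r))) ⟩
  ∑ (map summand (range 0 (suc r)))
    ≈⟨ sum-map-range-cong _ _ 0 (suc r) (λ a a≤r → summand≈ a (ℕₚ.≤-pred a≤r)) ⟩
  ∑ (map (λ a → ∑masks (suc k) (summandSubset a)) (range 0 (suc r)))
    ≈⟨ sum-map-∑masks (suc k) summandSubset (range 0 (suc r)) ⟩
  ∑masks (suc k) (λ L → ∑ (map (λ a → summandSubset a L) (range 0 (suc r))))
    ≈⟨ ∑masks-cong (suc k) sum-summandSubset ⟩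
  ∑masks (suc k) (term ∘ toSubset (suc k))
    ≈⟨ sym (sum-allSubsets (suc k) term) ⟩
  ∑ (map term (allSubsets (suc k)))
    ≈⟨ sym (sum-map-filter (λ A → ∣ A ∣ ≤? r) (Tu R k T) (allSubsets (suc k))) ⟩
  RHS R k r T ∎
  where
  open Ring R using (0#; sym)
  open Sums R using (∑; ∑masks; sum-map-range-cong; sum-map-∑masks; ∑masks-cong; sum-allSubsets; sum-map-filter)
  open Summand k r r≤k l R T using (summand; LHS≡sum-summand; summand≈; summandSubset)
  open SubsetContributions k r r≤k l R T H using (sum-summandSubset)
  open import Relation.Binary.Reasoning.Setoid (Ring.setoid R)
  term : Subset (suc k) → Ring.Carrier R
  term A = if does (∣ A ∣ ≤? r) then Tu R k T A else 0#
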